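{- For a word $\sigma$ of nonnegative integers avoiding $010$ and $110$, let $\mathrm{forb}(\sigma)$ be the number of values $v\in\{0,\dots,\max(\sigma)\}$ such that the word $\sigma\cdot M v$ (obtained by appending a letter $M>\max(\sigma)$ and then $v$) contains $010$ or $110$, with the convention $\mathrm{forb}(\text{empty word})=0$. For integers $n,k,f\geqslant 0$, let $\mathfrak{J}_{n,k,f}$ be the set of words $\omega$ of length $n$ over the alphabet $\{0, \dots, k-1\}$ avoiding both patterns $010$ and $110$ with $\mathrm{forb}(\omega) = f$, and let $\mathfrak{K}_{n,k}$ be the set of words of length $n$ over $\{0, \dots, k-1\}$ avoiding both $010$ and $110$. Let $\mathfrak{j}_{n,k,f} = \#\mathfrak{J}_{n,k,f}$ and $\mathfrak{k}_{n,k} = \#\mathfrak{K}_{n,k}$, so that $\mathfrak{k}_{n,k} = \sum_{f=0}^k \mathfrak{j}_{n,k,f}$. Then for all $n\geqslant 1$ and $k,f\geqslant 0$, $$\mathfrak{j}_{n,k,f} = \sum_{p=1}^{n} \sum_{i=0}^{f-1} \sum_{m=0}^{k-1} \mathfrak{j}_{p-1,m,i} \cdot \Big(\mathfrak{j}_{n-p, m-i, f-i-1} + \delta_{f, m+1} \cdot \sum_{\ell=0}^{n-p-1} \mathfrak{k}_{\ell, m-i}\Big),$$ where $\delta$ is the Kronecker delta.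
   Context: A word $\sigma$ contains a pattern $p=(p_1,\dots,p_k)$ if some subsequence $(\sigma_{i_1},\dots,\sigma_{i_k})$ with $i_1<\dots<i_k$ is order-isomorphic to $p$; otherwise it avoids $p$. Avoiding $010$ means no indices $a<b<c$ with $\sigma_a=\sigma_c<\sigma_b$; avoiding $110$ means no indices $a<b<c$ with $\sigma_a=\sigma_b>\sigma_c$. Words over $\{0,\dots,k-1\}$ need not use every letter; the alphabet is empty when $k=0$. $\delta_{a,b}=1$ if $a=b$ and $0$ otherwise. -}

module Defs where

open import Data.Nat using (ℕ; zero; suc; _+_; _*_; _∸_; _⊔_; _≟_)
import Data.Nat as ℕ
open import Data.Nat.Properties using () renaming (_<?_ to _<ℕ?_)
open import Data.Fin using (Fin) renaming (_<_ to _<ᶠ_; _<?_ to _<ᶠ?_)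
open import Data.Fin.Properties using (any?)
open import Data.List using (List; []; _∷_; length; lookup; upTo; map; concatMap; filter; foldr; _++_)
open import Data.Product using (∃; _×_; _,_)
open import Data.Sum using (_⊎_)
open import Data.Nat.ListAction using (sum)
open import Relation.Nullary using (Dec; yes; no)
open import Relation.Nullary.Decidable using (_×-dec_; _⊎-dec_; ¬?)
open import Relation.Nullary.Negation using (¬_)
open import Relation.Binary.PropositionalEquality using (_≡_)

Word : Set
Word = List ℕ

Contains010 : Word → Set
Contains010 σ = ∃ λ (a : Fin (length σ)) → ∃ λ b → ∃ λ c →
  a <ᶠ b × b <ᶠ c × lookup σ a ≡ lookup σ c × lookup σ a ℕ.< lookup σ b

Contains110 : Word → Set
Contains110 σ = ∃ λ (a : Fin (length σ)) → ∃ λ b → ∃ λ c →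
  a <ᶠ b × b <ᶠ c × lookup σ a ≡ lookup σ b × lookup σ c ℕ.< lookup σ a

contains010? : (σ : Word) → Dec (Contains010 σ)
contains010? σ = any? λ a → any? λ b → any? λ c →
  (a <ᶠ? b) ×-dec ((b <ᶠ? c) ×-dec ((lookup σ a ≟ lookup σ c) ×-dec (lookup σ a <ℕ? lookup σ b)))

contains110? : (σ : Word) → Dec (Contains110 σ)
contains110? σ = any? λ a → any? λ b → any? λ c →
  (a <ᶠ? b) ×-dec ((b <ᶠ? c) ×-dec ((lookup σ a ≟ lookup σ b) ×-dec (lookup σ c <ℕ? lookup σ a)))

Bad : Word → Set
Bad σ = Contains010 σ ⊎ Contains110 σ

bad? : (σ : Word) → Dec (Bad σ)
bad? σ = contains010? σ ⊎-dec contains110? σ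

Avoids : Word → Set
Avoids σ = ¬ Bad σ

avoids? : (σ : Word) → Dec (Avoids σ)
avoids? σ = ¬? (bad? σ)

maxW : Word → ℕ
maxW = foldr _⊔_ 0

forb : Word → ℕ
forb [] = 0
forb σ@(_ ∷ _) = length (filter (λ v → bad? (σ ++ (suc (maxW σ) ∷ v ∷ []))) (upTo (suc (maxW σ))))

allWords : ℕ → ℕ → List Word
allWords zero k = [] ∷ []
allWords (suc n) k = concatMap (λ a → map (a ∷_) (allWords n k)) (upTo k)

jj : ℕ → ℕ → ℕ → ℕ
jj n k f = length (filter (λ ω → avoids? ω ×-dec (forb ω ≟ f)) (allWords n k))

kk : ℕ → ℕ → ℕ
kk n k = length (filter avoids? (allWords n k))

δ : ℕ → ℕ → ℕ
δ a b with a ≟ b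
... | yes _ = 1
... | no _ = 0

Σ< : ℕ → (ℕ → ℕ) → ℕ
Σ< n g = sum (map g (upTo n))

-- Split a word ω at the first occurrence of its largest letter m: ω = α m β with α over
-- {0..m-1} and β over {0..m}. If β contains no further m, then ω avoids 010 and 110 iff α and β
-- do and β uses none of the forb α letters forbidden by α; ranking the m - forb α remaining
-- letters turns β into an arbitrary good word β′ over a smaller alphabet, with
-- forb ω = forb α + 1 + forb β′. If β contains a second m, everything after it must be m (else
-- m m y is a 110), and then every letter ≤ m is forbidden, so forb ω = m + 1: this gives the δ
-- term, summed over the position ℓ of the second m.
module Submission where

open import Defs

open import Data.Bool using (Bool; true; false; _∧_; _∨_; not; _xor_)
open import Data.Bool.ListAction using (all)
open import Data.Bool.Properties using (T-≡; T?; ∨-assoc; ∨-identityʳ; ∧-zeroʳ; ¬-not)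
open import Data.Empty using (⊥-elim)
open import Data.Fin using (Fin; zero; suc; toℕ)
open import Data.List using (List; []; _∷_; _++_; map; length; lookup; replicate; upTo; concatMap; filter; filterᵇ)
open import Data.List.Properties using (map-++; upTo-∷ʳ; map-upTo; filter-++; ++-identityʳ; ++-assoc)
open import Data.List.Relation.Unary.All using (All; []; _∷_)
import Data.List.Relation.Unary.All as All
open import Data.List.Relation.Unary.All.Properties using (applyUpTo⁺₁; all-filter; filter⁺; map⁺; ++⁺)
open import Data.Nat using (ℕ; zero; suc; _+_; _*_; _∸_; _≤_; _<_; _>_; _≡ᵇ_; _<ᵇ_; z≤n; s≤s; _⊔_; _≟_)
open import Data.Nat.ListAction using (sum)
open import Data.Nat.ListAction.Properties using (sum-++)
open import Data.Nat.Properties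
open import Algebra.Properties.CommutativeSemigroup +-commutativeSemigroup using (interchange)
open import Algebra.Properties.CommutativeSemigroup *-commutativeSemigroup
  using () renaming (x∙yz≈y∙xz to x*yz≡y*xz)
open import Data.Product using (∃; _×_; _,_; proj₁; proj₂)
open import Data.Sum using (_⊎_; inj₁; inj₂)
open import Data.Vec using (Vec; []; _∷_)
open import Function using (_∘_; Equivalence)
open import Relation.Binary using (Tri; tri<; tri≈; tri>)
open import Relation.Binary.PropositionalEquality
open import Relation.Nullary using (yes; no; does; proof)
open import Relation.Nullary.Decidable using (_×-dec_)
open import Relation.Nullary.Reflects using (fromEquivalence; det)
open import Relation.Unary using (Decidable)

𝟙 : Bool → ℕ
𝟙 true = 1
𝟙 false = 0

_⇔ᵇ_ : Bool → Bool → Bool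
a ⇔ᵇ b = not (a xor b)

_⇒ᵇ_ : Bool → Bool → Bool
a ⇒ᵇ b = not a ∨ b

-- Boolean identities below are proved by evaluating all rows of their truth table.
valid : (n : ℕ) → (Vec Bool n → Bool) → Bool
valid zero P = P []
valid (suc n) P = valid n (P ∘ (true ∷_)) ∧ valid n (P ∘ (false ∷_))

∧-true⁻ˡ : ∀ {a b} → a ∧ b ≡ true → a ≡ true
∧-true⁻ˡ {true} _ = refl

∧-true⁻ʳ : ∀ {a b} → a ∧ b ≡ true → b ≡ true
∧-true⁻ʳ {true} h = h

∧-true⁺ : ∀ {a b} → a ≡ true → b ≡ true → a ∧ b ≡ true
∧-true⁺ refl refl = refl

∨-true⁻ : ∀ {a b} → a ∨ b ≡ true → a ≡ true ⊎ b ≡ true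
∨-true⁻ {true} _ = inj₁ refl
∨-true⁻ {false} h = inj₂ h

∨-false⁻ : ∀ {a b} → a ∨ b ≡ false → a ≡ false × b ≡ false
∨-false⁻ {false} h = refl , h

∨-trueˡ : ∀ {a} b → a ≡ true → a ∨ b ≡ true
∨-trueˡ b refl = refl

∨-trueʳ : ∀ a {b} → b ≡ true → a ∨ b ≡ true
∨-trueʳ true _ = refl
∨-trueʳ false h = h

valid-sound : ∀ n P → valid n P ≡ true → ∀ v → P v ≡ true
valid-sound zero P h [] = h
valid-sound (suc n) P h (true ∷ v) = valid-sound n _ (∧-true⁻ˡ h) v
valid-sound (suc n) P h (false ∷ v) = valid-sound n _ (∧-true⁻ʳ h) v

⇔ᵇ-true⁻ : ∀ {a b} → (a ⇔ᵇ b) ≡ true → a ≡ b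
⇔ᵇ-true⁻ {true} {true} _ = refl
⇔ᵇ-true⁻ {false} {false} _ = refl

⇒ᵇ-true⁻ : ∀ {a b} → (a ⇒ᵇ b) ≡ true → a ≡ true → b ≡ true
⇒ᵇ-true⁻ {true} h refl = h

⇒ᵇ-true⁺ : ∀ {a b} → (a ≡ true → b ≡ true) → (a ⇒ᵇ b) ≡ true
⇒ᵇ-true⁺ {true} h = h refl
⇒ᵇ-true⁺ {false} h = refl

𝟙-∧ : ∀ a b → 𝟙 (a ∧ b) ≡ 𝟙 a * 𝟙 b
𝟙-∧ true b = sym (+-identityʳ (𝟙 b))
𝟙-∧ false b = refl

≡ᵇ-sound : ∀ {x y} → (x ≡ᵇ y) ≡ true → x ≡ y
≡ᵇ-sound {x} {y} h = ≡ᵇ⇒≡ x y (Equivalence.from T-≡ h)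

≡ᵇ-complete : ∀ {x y} → x ≡ y → (x ≡ᵇ y) ≡ true
≡ᵇ-complete {x} {y} h = Equivalence.to T-≡ (≡⇒≡ᵇ x y h)

<ᵇ-sound : ∀ {x y} → (x <ᵇ y) ≡ true → x < y
<ᵇ-sound {x} {y} h = <ᵇ⇒< x y (Equivalence.from T-≡ h)

<ᵇ-complete : ∀ {x y} → x < y → (x <ᵇ y) ≡ true
<ᵇ-complete h = Equivalence.to T-≡ (<⇒<ᵇ h)

≡ᵇ-refl : ∀ x → (x ≡ᵇ x) ≡ true
≡ᵇ-refl x = ≡ᵇ-complete {x} refl

≡ᵇ-sym : ∀ x y → (x ≡ᵇ y) ≡ (y ≡ᵇ x)
≡ᵇ-sym x y with x ≡ᵇ y in e | y ≡ᵇ x in e′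
... | true | true = refl
... | false | false = refl
... | true | false = trans (sym (≡ᵇ-complete (sym (≡ᵇ-sound {x} e)))) e′
... | false | true = trans (sym e) (≡ᵇ-complete (sym (≡ᵇ-sound {y} e′)))

<⇒≢ᵇ : ∀ {x y} → x < y → (x ≡ᵇ y) ≡ false
<⇒≢ᵇ {x} {y} l = ¬-not λ e → <-irrefl (≡ᵇ-sound e) l

>⇒≢ᵇ : ∀ {x y} → y < x → (x ≡ᵇ y) ≡ false
>⇒≢ᵇ {x} {y} l = ¬-not λ e → <-irrefl (sym (≡ᵇ-sound e)) l

≥⇒≮ᵇ : ∀ {x y} → y ≤ x → (x <ᵇ y) ≡ false
≥⇒≮ᵇ {x} {y} l = ¬-not λ e → <⇒≱ (<ᵇ-sound e) l

contraposeᵇ : ∀ {a b} → (a ≡ true → b ≡ true) → b ≡ false → a ≡ false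
contraposeᵇ {false} _ _ = refl
contraposeᵇ {true} a⇒b refl with () ← a⇒b refl

-- Deciding 010 and 110 by Boolean functions

occurs : ℕ → Word → Bool
occurs x [] = false
occurs x (y ∷ σ) = (x ≡ᵇ y) ∨ occurs x σ

anyBelow : ℕ → Word → Bool
anyBelow x [] = false
anyBelow x (y ∷ σ) = (y <ᵇ x) ∨ anyBelow x σ

anyAbove : ℕ → Word → Bool
anyAbove x [] = false
anyAbove x (y ∷ σ) = (x <ᵇ y) ∨ anyAbove x σ

head010 : ℕ → Word → Bool
head010 x [] = false
head010 x (y ∷ σ) = ((x <ᵇ y) ∧ occurs x σ) ∨ head010 x σ

head110 : ℕ → Word → Bool
head110 x [] = false
head110 x (y ∷ σ) = ((x ≡ᵇ y) ∧ anyBelow x σ) ∨ head110 x σ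

isBad : Word → Bool
isBad [] = false
isBad (x ∷ σ) = (head010 x σ ∨ head110 x σ) ∨ isBad σ

Occurs : ℕ → Word → Set
Occurs x σ = ∃ λ (c : Fin (length σ)) → x ≡ lookup σ c

HasBelow : ℕ → Word → Set
HasBelow x σ = ∃ λ (c : Fin (length σ)) → lookup σ c < x

Head010 : ℕ → Word → Set
Head010 x σ = ∃ λ (b : Fin (length σ)) → ∃ λ c → toℕ b < toℕ c × x ≡ lookup σ c × x < lookup σ b

Head110 : ℕ → Word → Set
Head110 x σ = ∃ λ (b : Fin (length σ)) → ∃ λ c → toℕ b < toℕ c × x ≡ lookup σ b × lookup σ c < x

occurs-sound : ∀ x σ → occurs x σ ≡ true → Occurs x σ
occurs-sound x (y ∷ σ) h with ∨-true⁻ {x ≡ᵇ y} h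
... | inj₁ e = zero , ≡ᵇ-sound e
... | inj₂ e with occurs-sound x σ e
... | c , q = suc c , q

occurs-complete : ∀ x σ → Occurs x σ → occurs x σ ≡ true
occurs-complete x (y ∷ σ) (zero , q) = ∨-trueˡ (occurs x σ) (≡ᵇ-complete q)
occurs-complete x (y ∷ σ) (suc c , q) = ∨-trueʳ (x ≡ᵇ y) (occurs-complete x σ (c , q))

anyBelow-sound : ∀ x σ → anyBelow x σ ≡ true → HasBelow x σ
anyBelow-sound x (y ∷ σ) h with ∨-true⁻ {y <ᵇ x} h
... | inj₁ e = zero , <ᵇ-sound e
... | inj₂ e with anyBelow-sound x σ e
... | c , q = suc c , q

anyBelow-complete : ∀ x σ → HasBelow x σ → anyBelow x σ ≡ true
anyBelow-complete x (y ∷ σ) (zero , q) = ∨-trueˡ (anyBelow x σ) (<ᵇ-complete q)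
anyBelow-complete x (y ∷ σ) (suc c , q) = ∨-trueʳ (y <ᵇ x) (anyBelow-complete x σ (c , q))

head010-sound : ∀ x σ → head010 x σ ≡ true → Head010 x σ
head010-sound x (y ∷ σ) h with ∨-true⁻ {(x <ᵇ y) ∧ occurs x σ} h
... | inj₁ e with occurs-sound x σ (∧-true⁻ʳ {x <ᵇ y} e)
... | c , q = zero , suc c , s≤s z≤n , q , <ᵇ-sound (∧-true⁻ˡ e)
head010-sound x (y ∷ σ) h | inj₂ e with head010-sound x σ e
... | b , c , b<c , q , l = suc b , suc c , s≤s b<c , q , l

head010-complete : ∀ x σ → Head010 x σ → head010 x σ ≡ true
head010-complete x (y ∷ σ) (zero , suc c , _ , q , l) =
  ∨-trueˡ (head010 x σ) (∧-true⁺ (<ᵇ-complete l) (occurs-complete x σ (c , q)))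
head010-complete x (y ∷ σ) (suc b , suc c , s≤s b<c , q , l) =
  ∨-trueʳ ((x <ᵇ y) ∧ occurs x σ) (head010-complete x σ (b , c , b<c , q , l))

head110-sound : ∀ x σ → head110 x σ ≡ true → Head110 x σ
head110-sound x (y ∷ σ) h with ∨-true⁻ {(x ≡ᵇ y) ∧ anyBelow x σ} h
... | inj₁ e with anyBelow-sound x σ (∧-true⁻ʳ {x ≡ᵇ y} e)
... | c , q = zero , suc c , s≤s z≤n , ≡ᵇ-sound (∧-true⁻ˡ e) , q
head110-sound x (y ∷ σ) h | inj₂ e with head110-sound x σ e
... | b , c , b<c , q , l = suc b , suc c , s≤s b<c , q , l

head110-complete : ∀ x σ → Head110 x σ → head110 x σ ≡ true
head110-complete x (y ∷ σ) (zero , suc c , _ , q , l) =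
  ∨-trueˡ (head110 x σ) (∧-true⁺ (≡ᵇ-complete q) (anyBelow-complete x σ (c , l)))
head110-complete x (y ∷ σ) (suc b , suc c , s≤s b<c , q , l) =
  ∨-trueʳ ((x ≡ᵇ y) ∧ anyBelow x σ) (head110-complete x σ (b , c , b<c , q , l))

Contains010-∷⁻ : ∀ x σ → Contains010 (x ∷ σ) → Contains010 σ ⊎ Head010 x σ
Contains010-∷⁻ x σ (zero , suc b , suc c , _ , s≤s b<c , e , l) = inj₂ (b , c , b<c , e , l)
Contains010-∷⁻ x σ (suc a , suc b , suc c , s≤s a<b , s≤s b<c , e , l) = inj₁ (a , b , c , a<b , b<c , e , l)

Contains110-∷⁻ : ∀ x σ → Contains110 (x ∷ σ) → Contains110 σ ⊎ Head110 x σ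
Contains110-∷⁻ x σ (zero , suc b , suc c , _ , s≤s b<c , e , l) = inj₂ (b , c , b<c , e , l)
Contains110-∷⁻ x σ (suc a , suc b , suc c , s≤s a<b , s≤s b<c , e , l) = inj₁ (a , b , c , a<b , b<c , e , l)

isBad-complete : ∀ σ → Bad σ → isBad σ ≡ true
isBad-complete (x ∷ σ) (inj₁ c) with Contains010-∷⁻ x σ c
... | inj₁ c′ = ∨-trueʳ (head010 x σ ∨ head110 x σ) (isBad-complete σ (inj₁ c′))
... | inj₂ q = ∨-trueˡ (isBad σ) (∨-trueˡ (head110 x σ) (head010-complete x σ q))
isBad-complete (x ∷ σ) (inj₂ c) with Contains110-∷⁻ x σ c
... | inj₁ c′ = ∨-trueʳ (head010 x σ ∨ head110 x σ) (isBad-complete σ (inj₂ c′))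
... | inj₂ q = ∨-trueˡ (isBad σ) (∨-trueʳ (head010 x σ) (head110-complete x σ q))

isBad-sound : ∀ σ → isBad σ ≡ true → Bad σ
isBad-sound (x ∷ σ) h with ∨-true⁻ {head010 x σ ∨ head110 x σ} h
... | inj₂ e with isBad-sound σ e
... | inj₁ (a , b , c , a<b , b<c , q , l) = inj₁ (suc a , suc b , suc c , s≤s a<b , s≤s b<c , q , l)
... | inj₂ (a , b , c , a<b , b<c , q , l) = inj₂ (suc a , suc b , suc c , s≤s a<b , s≤s b<c , q , l)
isBad-sound (x ∷ σ) h | inj₁ e with ∨-true⁻ {head010 x σ} e
... | inj₁ e₁ with head010-sound x σ e₁
... | b , c , b<c , q , l = inj₁ (zero , suc b , suc c , s≤s z≤n , s≤s b<c , q , l)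
isBad-sound (x ∷ σ) h | inj₁ e | inj₂ e₂ with head110-sound x σ e₂
... | b , c , b<c , q , l = inj₂ (zero , suc b , suc c , s≤s z≤n , s≤s b<c , q , l)

does-bad? : ∀ σ → does (bad? σ) ≡ isBad σ
does-bad? σ = det (proof (bad? σ))
  (fromEquivalence (isBad-sound σ ∘ Equivalence.to T-≡) (Equivalence.from T-≡ ∘ isBad-complete σ))

occurs-++ : ∀ x σ τ → occurs x (σ ++ τ) ≡ occurs x σ ∨ occurs x τ
occurs-++ x [] τ = refl
occurs-++ x (y ∷ σ) τ rewrite occurs-++ x σ τ = sym (∨-assoc (x ≡ᵇ y) (occurs x σ) (occurs x τ))

anyBelow-++ : ∀ x σ τ → anyBelow x (σ ++ τ) ≡ anyBelow x σ ∨ anyBelow x τ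
anyBelow-++ x [] τ = refl
anyBelow-++ x (y ∷ σ) τ rewrite anyBelow-++ x σ τ = sym (∨-assoc (y <ᵇ x) (anyBelow x σ) (anyBelow x τ))

private
  regroup-++ : ∀ a m₁ m₂ p₁ g p₂ →
    ((a ∧ (m₁ ∨ m₂)) ∨ (p₁ ∨ ((g ∧ m₂) ∨ p₂))) ≡ (((a ∧ m₁) ∨ p₁) ∨ (((a ∨ g) ∧ m₂) ∨ p₂))
  regroup-++ a m₁ m₂ p₁ g p₂ = ⇔ᵇ-true⁻ (valid-sound 6 (λ { (a ∷ m₁ ∷ m₂ ∷ p₁ ∷ g ∷ p₂ ∷ []) →
    ((a ∧ (m₁ ∨ m₂)) ∨ (p₁ ∨ ((g ∧ m₂) ∨ p₂))) ⇔ᵇ (((a ∧ m₁) ∨ p₁) ∨ (((a ∨ g) ∧ m₂) ∨ p₂)) }) refl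
    (a ∷ m₁ ∷ m₂ ∷ p₁ ∷ g ∷ p₂ ∷ []))

head010-++ : ∀ x σ τ → head010 x (σ ++ τ) ≡ head010 x σ ∨ ((anyAbove x σ ∧ occurs x τ) ∨ head010 x τ)
head010-++ x [] τ = refl
head010-++ x (y ∷ σ) τ rewrite occurs-++ x σ τ | head010-++ x σ τ =
  regroup-++ (x <ᵇ y) (occurs x σ) (occurs x τ) (head010 x σ) (anyAbove x σ) (head010 x τ)

head110-++ : ∀ x σ τ → head110 x (σ ++ τ) ≡ head110 x σ ∨ ((occurs x σ ∧ anyBelow x τ) ∨ head110 x τ)
head110-++ x [] τ = refl
head110-++ x (y ∷ σ) τ rewrite anyBelow-++ x σ τ | head110-++ x σ τ =
  regroup-++ (x ≡ᵇ y) (anyBelow x σ) (anyBelow x τ) (head110 x σ) (occurs x σ) (head110 x τ)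

head010⇒occurs : ∀ x σ → head010 x σ ≡ true → occurs x σ ≡ true
head010⇒occurs x (y ∷ σ) h with ∨-true⁻ {(x <ᵇ y) ∧ occurs x σ} h
... | inj₁ e = ∨-trueʳ (x ≡ᵇ y) (∧-true⁻ʳ {x <ᵇ y} e)
... | inj₂ e = ∨-trueʳ (x ≡ᵇ y) (head010⇒occurs x σ e)

head010⇒anyAbove : ∀ x σ → head010 x σ ≡ true → anyAbove x σ ≡ true
head010⇒anyAbove x (y ∷ σ) h with ∨-true⁻ {(x <ᵇ y) ∧ occurs x σ} h
... | inj₁ e = ∨-trueˡ (anyAbove x σ) (∧-true⁻ˡ e)
... | inj₂ e = ∨-trueʳ (x <ᵇ y) (head010⇒anyAbove x σ e)

head110⇒occurs : ∀ x σ → head110 x σ ≡ true → occurs x σ ≡ true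
head110⇒occurs x (y ∷ σ) h with ∨-true⁻ {(x ≡ᵇ y) ∧ anyBelow x σ} h
... | inj₁ e = ∨-trueˡ (occurs x σ) (∧-true⁻ˡ e)
... | inj₂ e = ∨-trueʳ (x ≡ᵇ y) (head110⇒occurs x σ e)

head110⇒anyBelow : ∀ x σ → head110 x σ ≡ true → anyBelow x σ ≡ true
head110⇒anyBelow x (y ∷ σ) h with ∨-true⁻ {(x ≡ᵇ y) ∧ anyBelow x σ} h
... | inj₁ e = ∨-trueʳ (y <ᵇ x) (∧-true⁻ʳ {x ≡ᵇ y} e)
... | inj₂ e = ∨-trueʳ (y <ᵇ x) (head110⇒anyBelow x σ e)

occurs-all< : ∀ {m} σ → All (_< m) σ → occurs m σ ≡ false
occurs-all< [] [] = refl
occurs-all< {m} (y ∷ σ) (l ∷ ls) rewrite >⇒≢ᵇ {m} {y} l = occurs-all< σ ls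

anyAbove-all≤ : ∀ {m} σ → All (_≤ m) σ → anyAbove m σ ≡ false
anyAbove-all≤ [] [] = refl
anyAbove-all≤ {m} (y ∷ σ) (l ∷ ls) rewrite ≥⇒≮ᵇ {m} {y} l = anyAbove-all≤ σ ls

head010-all≤ : ∀ {m} σ → All (_≤ m) σ → head010 m σ ≡ false
head010-all≤ σ ls = contraposeᵇ (head010⇒anyAbove _ σ) (anyAbove-all≤ σ ls)

head110-all< : ∀ {m} σ → All (_< m) σ → head110 m σ ≡ false
head110-all< σ ls = contraposeᵇ (head110⇒occurs _ σ) (occurs-all< σ ls)

isBad-++ˡ : ∀ σ τ → isBad σ ≡ true → isBad (σ ++ τ) ≡ true
isBad-++ˡ (x ∷ σ) τ h with ∨-true⁻ {head010 x σ ∨ head110 x σ} h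
... | inj₂ e = ∨-trueʳ (head010 x (σ ++ τ) ∨ head110 x (σ ++ τ)) (isBad-++ˡ σ τ e)
... | inj₁ e with ∨-true⁻ {head010 x σ} e
... | inj₁ e₁ = ∨-trueˡ (isBad (σ ++ τ)) (∨-trueˡ (head110 x (σ ++ τ))
        (subst (_≡ true) (sym (head010-++ x σ τ)) (∨-trueˡ _ e₁)))
... | inj₂ e₂ = ∨-trueˡ (isBad (σ ++ τ)) (∨-trueʳ (head010 x (σ ++ τ))
        (subst (_≡ true) (sym (head110-++ x σ τ)) (∨-trueˡ _ e₂)))

isBad-++ʳ : ∀ σ τ → isBad τ ≡ true → isBad (σ ++ τ) ≡ true
isBad-++ʳ [] τ h = h
isBad-++ʳ (x ∷ σ) τ h = ∨-trueʳ (head010 x (σ ++ τ) ∨ head110 x (σ ++ τ)) (isBad-++ʳ σ τ h)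

occurs-replicate : ∀ {x m} j → x < m → occurs x (replicate j m) ≡ false
occurs-replicate zero l = refl
occurs-replicate {x} {m} (suc j) l rewrite <⇒≢ᵇ {x} {m} l = occurs-replicate j l

anyBelow-replicate : ∀ {x m} j → x ≤ m → anyBelow x (replicate j m) ≡ false
anyBelow-replicate zero l = refl
anyBelow-replicate {x} {m} (suc j) l rewrite ≥⇒≮ᵇ {m} {x} l = anyBelow-replicate j l

head010-replicate : ∀ {x m} j → x ≤ m → head010 x (replicate j m) ≡ false
head010-replicate zero l = refl
head010-replicate {x} {m} (suc j) l with m≤n⇒m<n∨m≡n l
... | inj₁ x<m rewrite occurs-replicate {x} {m} j x<m | head010-replicate {x} {m} j l | ∧-zeroʳ (x <ᵇ m) = refl
... | inj₂ refl rewrite ≥⇒≮ᵇ {x} {x} ≤-refl = head010-replicate {x} {x} j l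

head110-replicate : ∀ {x m} j → x ≤ m → head110 x (replicate j m) ≡ false
head110-replicate {x} {m} j l = contraposeᵇ (head110⇒anyBelow x (replicate j m)) (anyBelow-replicate j l)

isBad-replicate : ∀ j m → isBad (replicate j m) ≡ false
isBad-replicate zero m = refl
isBad-replicate (suc j) m
  rewrite head010-replicate {m} {m} j ≤-refl | head110-replicate {m} {m} j ≤-refl = isBad-replicate j m

isBad-++-replicate : ∀ m j σ → All (_≤ m) σ → isBad (σ ++ replicate (suc j) m) ≡ isBad σ
isBad-++-replicate m j [] [] = isBad-replicate (suc j) m
isBad-++-replicate m j (x ∷ σ) (x≤m ∷ σ≤m)
  rewrite head010-++ x σ (replicate (suc j) m) | head110-++ x σ (replicate (suc j) m)
        | isBad-++-replicate m j σ σ≤m | head010-replicate {x} {m} (suc j) x≤m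
        | head110-replicate {x} {m} (suc j) x≤m | anyBelow-replicate {x} {m} (suc j) x≤m =
  drop-false (head010 x σ) (head110 x σ) (isBad σ) (anyAbove x σ) (occurs x (replicate (suc j) m)) (occurs x σ)
    no-010-through-m
  where
  no-010-through-m : (anyAbove x σ ∧ occurs x (replicate (suc j) m)) ≡ false
  no-010-through-m with m≤n⇒m<n∨m≡n x≤m
  ... | inj₁ x<m rewrite occurs-replicate {x} {m} (suc j) x<m = ∧-zeroʳ (anyAbove x σ)
  ... | inj₂ refl rewrite anyAbove-all≤ {x} σ σ≤m = refl
  drop-false : ∀ p₁ p₂ b g o o′ → (g ∧ o) ≡ false →
    ((p₁ ∨ ((g ∧ o) ∨ false)) ∨ (p₂ ∨ ((o′ ∧ false) ∨ false))) ∨ b ≡ (p₁ ∨ p₂) ∨ b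
  drop-false p₁ p₂ b g o o′ h = ⇔ᵇ-true⁻ (⇒ᵇ-true⁻ (valid-sound 6 (λ { (p₁ ∷ p₂ ∷ b ∷ g ∷ o ∷ o′ ∷ []) →
    not (g ∧ o) ⇒ᵇ ((((p₁ ∨ ((g ∧ o) ∨ false)) ∨ (p₂ ∨ ((o′ ∧ false) ∨ false))) ∨ b) ⇔ᵇ ((p₁ ∨ p₂) ∨ b)) }) refl
    (p₁ ∷ p₂ ∷ b ∷ g ∷ o ∷ o′ ∷ [])) (cong not h))

-- forbids σ v: σ M v has an occurrence of 010 or 110 ending in v, for any M above the letters of σ.
forbids : Word → ℕ → Bool
forbids [] v = false
forbids (x ∷ σ) v = (v ≡ᵇ x) ∨ (((v <ᵇ x) ∧ occurs x σ) ∨ forbids σ v)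

anyForbidden : Word → Word → Bool
anyForbidden α [] = false
anyForbidden α (y ∷ γ) = forbids α y ∨ anyForbidden α γ

anyForbidden-[] : ∀ γ → anyForbidden [] γ ≡ false
anyForbidden-[] [] = refl
anyForbidden-[] (y ∷ γ) = anyForbidden-[] γ

anyForbidden-∷ : ∀ x α γ → anyForbidden (x ∷ α) γ ≡ occurs x γ ∨ ((occurs x α ∧ anyBelow x γ) ∨ anyForbidden α γ)
anyForbidden-∷ x α [] rewrite ∧-zeroʳ (occurs x α) = refl
anyForbidden-∷ x α (y ∷ γ) rewrite anyForbidden-∷ x α γ | ≡ᵇ-sym y x =
  regroup (x ≡ᵇ y) (y <ᵇ x) (occurs x α) (forbids α y) (occurs x γ) (anyBelow x γ) (anyForbidden α γ)
  where
  regroup : ∀ e l o f o′ b a →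
    ((e ∨ ((l ∧ o) ∨ f)) ∨ (o′ ∨ ((o ∧ b) ∨ a))) ≡ ((e ∨ o′) ∨ ((o ∧ (l ∨ b)) ∨ (f ∨ a)))
  regroup e l o f o′ b a = ⇔ᵇ-true⁻ (valid-sound 7 (λ { (e ∷ l ∷ o ∷ f ∷ o′ ∷ b ∷ a ∷ []) →
    ((e ∨ ((l ∧ o) ∨ f)) ∨ (o′ ∨ ((o ∧ b) ∨ a))) ⇔ᵇ ((e ∨ o′) ∨ ((o ∧ (l ∨ b)) ∨ (f ∨ a))) }) refl
    (e ∷ l ∷ o ∷ f ∷ o′ ∷ b ∷ a ∷ []))

-- An occurrence of 010 or 110 lying neither in α nor in γ starts in α and ends in γ
-- (m can only be the middle letter of a 010); these are exactly what anyForbidden detects.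
isBad-++-∷ : ∀ m α γ → All (_< m) α → All (_< m) γ →
  isBad (α ++ m ∷ γ) ≡ isBad α ∨ (isBad γ ∨ anyForbidden α γ)
isBad-++-∷ m [] γ [] γ<m
  rewrite head010-all≤ {m} γ (All.map <⇒≤ γ<m) | head110-all< {m} γ γ<m | anyForbidden-[] γ =
  sym (∨-identityʳ (isBad γ))
isBad-++-∷ m (x ∷ α) γ (x<m ∷ α<m) γ<m
  rewrite head010-++ x α (m ∷ γ) | head110-++ x α (m ∷ γ) | isBad-++-∷ m α γ α<m γ<m
        | anyForbidden-∷ x α γ | <⇒≢ᵇ x<m | <ᵇ-complete x<m | ≥⇒≮ᵇ (<⇒≤ x<m) =
  regroup (head010 x α) (head110 x α) (isBad α) (isBad γ) (anyForbidden α γ) (anyAbove x α)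
    (occurs x γ) (head010 x γ) (head110 x γ) (occurs x α) (anyBelow x γ)
    (⇒ᵇ-true⁺ (head010⇒occurs x γ)) (⇒ᵇ-true⁺ (head110⇒occurs x γ))
  where
  regroup : ∀ p₁ p₂ b b′ a g o q₁ q₂ o′ l → (q₁ ⇒ᵇ o) ≡ true → (q₂ ⇒ᵇ o) ≡ true →
    (((p₁ ∨ ((g ∧ (false ∨ o)) ∨ ((true ∧ o) ∨ q₁))) ∨ (p₂ ∨ ((o′ ∧ (false ∨ l)) ∨ ((false ∧ l) ∨ q₂)))) ∨ (b ∨ (b′ ∨ a)))
      ≡ (((p₁ ∨ p₂) ∨ b) ∨ (b′ ∨ (o ∨ ((o′ ∧ l) ∨ a))))
  regroup p₁ p₂ b b′ a g o q₁ q₂ o′ l h₁ h₂ = ⇔ᵇ-true⁻ (⇒ᵇ-true⁻ (⇒ᵇ-true⁻ (valid-sound 11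
    (λ { (p₁ ∷ p₂ ∷ b ∷ b′ ∷ a ∷ g ∷ o ∷ q₁ ∷ q₂ ∷ o′ ∷ l ∷ []) → (q₁ ⇒ᵇ o) ⇒ᵇ ((q₂ ⇒ᵇ o) ⇒ᵇ
      ((((p₁ ∨ ((g ∧ (false ∨ o)) ∨ ((true ∧ o) ∨ q₁))) ∨ (p₂ ∨ ((o′ ∧ (false ∨ l)) ∨ ((false ∧ l) ∨ q₂)))) ∨ (b ∨ (b′ ∨ a)))
        ⇔ᵇ (((p₁ ∨ p₂) ∨ b) ∨ (b′ ∨ (o ∨ ((o′ ∧ l) ∨ a)))))) }) refl
    (p₁ ∷ p₂ ∷ b ∷ b′ ∷ a ∷ g ∷ o ∷ q₁ ∷ q₂ ∷ o′ ∷ l ∷ [])) h₁) h₂)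

forbids-++ʳ : ∀ σ τ v → forbids τ v ≡ true → forbids (σ ++ τ) v ≡ true
forbids-++ʳ [] τ v h = h
forbids-++ʳ (x ∷ σ) τ v h = ∨-trueʳ (v ≡ᵇ x) (∨-trueʳ ((v <ᵇ x) ∧ occurs x (σ ++ τ)) (forbids-++ʳ σ τ v h))

forbids⇒< : ∀ {K} σ v → All (_< K) σ → forbids σ v ≡ true → v < K
forbids⇒< (x ∷ σ) v (x<K ∷ σ<K) h with ∨-true⁻ {v ≡ᵇ x} h
... | inj₁ e = subst (_< _) (sym (≡ᵇ-sound e)) x<K
... | inj₂ e with ∨-true⁻ {(v <ᵇ x) ∧ occurs x σ} e
... | inj₁ e′ = <-trans (<ᵇ-sound (∧-true⁻ˡ e′)) x<K
... | inj₂ e′ = forbids⇒< σ v σ<K e′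

forbids-repeated : ∀ m τ v → v ≤ m → occurs m τ ≡ true → forbids (m ∷ τ) v ≡ true
forbids-repeated m τ v v≤m h with m≤n⇒m<n∨m≡n v≤m
... | inj₁ v<m = ∨-trueʳ (v ≡ᵇ m) (∨-trueˡ (forbids τ v) (∧-true⁺ (<ᵇ-complete v<m) h))
... | inj₂ refl = ∨-trueˡ _ (≡ᵇ-refl v)

forbids-++-∷-self : ∀ m α γ → forbids (α ++ m ∷ γ) m ≡ true
forbids-++-∷-self m α γ = forbids-++ʳ α (m ∷ γ) m (∨-trueˡ _ (≡ᵇ-refl m))

forbids-++-∷ : ∀ m α γ v → All (_< m) α → All (_< m) γ → anyForbidden α γ ≡ false → v < m →
  forbids (α ++ m ∷ γ) v ≡ forbids α v ∨ forbids γ v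
forbids-++-∷ m [] γ v [] γ<m _ v<m rewrite <⇒≢ᵇ v<m | occurs-all< γ γ<m | ∧-zeroʳ (v <ᵇ m) = refl
forbids-++-∷ m (x ∷ α) γ v (x<m ∷ α<m) γ<m h v<m
  with h′ ← subst (_≡ false) (anyForbidden-∷ x α γ) h
  rewrite occurs-++ x α (m ∷ γ)
        | forbids-++-∷ m α γ v α<m γ<m (proj₂ (∨-false⁻ {occurs x α ∧ anyBelow x γ} (proj₂ (∨-false⁻ {occurs x γ} h′)))) v<m =
  regroup (v ≡ᵇ x) (v <ᵇ x) (occurs x α) (x ≡ᵇ m) (occurs x γ) (forbids α v) (forbids γ v)
    (<⇒≢ᵇ x<m) (proj₁ (∨-false⁻ {occurs x γ} h′))
  where
  regroup : ∀ e l o e′ o′ f f′ → e′ ≡ false → o′ ≡ false →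
    (e ∨ ((l ∧ (o ∨ (e′ ∨ o′))) ∨ (f ∨ f′))) ≡ ((e ∨ ((l ∧ o) ∨ f)) ∨ f′)
  regroup e l o _ _ f f′ refl refl = ⇔ᵇ-true⁻ (valid-sound 5 (λ { (e ∷ l ∷ o ∷ f ∷ f′ ∷ []) →
    (e ∨ ((l ∧ (o ∨ (false ∨ false))) ∨ (f ∨ f′))) ⇔ᵇ ((e ∨ ((l ∧ o) ∨ f)) ∨ f′) }) refl (e ∷ l ∷ o ∷ f ∷ f′ ∷ []))

isBad-++-Mv : ∀ M v σ → All (_< M) σ → isBad (σ ++ M ∷ v ∷ []) ≡ isBad σ ∨ forbids σ v
isBad-++-Mv M v [] [] with M <ᵇ v | M ≡ᵇ v
... | true | true = refl
... | true | false = refl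
... | false | true = refl
... | false | false = refl
isBad-++-Mv M v (x ∷ σ) (x<M ∷ σ<M)
  rewrite head010-++ x σ (M ∷ v ∷ []) | head110-++ x σ (M ∷ v ∷ []) | isBad-++-Mv M v σ σ<M | ≡ᵇ-sym v x
        | <⇒≢ᵇ x<M | <ᵇ-complete x<M | ≥⇒≮ᵇ (<⇒≤ x<M) =
  regroup (head010 x σ) (head110 x σ) (isBad σ) (forbids σ v) (anyAbove x σ) (occurs x σ) (x ≡ᵇ v) (x <ᵇ v) (v <ᵇ x)
  where
  regroup : ∀ p₁ p₂ b f g o e l l′ →
    ((p₁ ∨ ((g ∧ (false ∨ (e ∨ false))) ∨ ((true ∧ (e ∨ false)) ∨ ((l ∧ false) ∨ false))))
      ∨ (p₂ ∨ ((o ∧ (false ∨ (l′ ∨ false))) ∨ ((false ∧ (l′ ∨ false)) ∨ ((e ∧ false) ∨ false))))) ∨ (b ∨ f)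
    ≡ ((p₁ ∨ p₂) ∨ b) ∨ (e ∨ ((l′ ∧ o) ∨ f))
  regroup p₁ p₂ b f g o e l l′ = ⇔ᵇ-true⁻ (valid-sound 9 (λ { (p₁ ∷ p₂ ∷ b ∷ f ∷ g ∷ o ∷ e ∷ l ∷ l′ ∷ []) →
    (((p₁ ∨ ((g ∧ (false ∨ (e ∨ false))) ∨ ((true ∧ (e ∨ false)) ∨ ((l ∧ false) ∨ false))))
      ∨ (p₂ ∨ ((o ∧ (false ∨ (l′ ∨ false))) ∨ ((false ∧ (l′ ∨ false)) ∨ ((e ∧ false) ∨ false))))) ∨ (b ∨ f))
    ⇔ᵇ (((p₁ ∨ p₂) ∨ b) ∨ (e ∨ ((l′ ∧ o) ∨ f))) }) refl (p₁ ∷ p₂ ∷ b ∷ f ∷ g ∷ o ∷ e ∷ l ∷ l′ ∷ []))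

-- Finite sums and words over an alphabet

∑ : {A : Set} → List A → (A → ℕ) → ℕ
∑ xs f = sum (map f xs)

private variable
  A B : Set

∑-cong : (xs : List A) {f g : A → ℕ} → (∀ x → f x ≡ g x) → ∑ xs f ≡ ∑ xs g
∑-cong [] _ = refl
∑-cong (x ∷ xs) f≗g = cong₂ _+_ (f≗g x) (∑-cong xs f≗g)

∑-cong-All : {P : A → Set} (xs : List A) {f g : A → ℕ} → All P xs → (∀ x → P x → f x ≡ g x) → ∑ xs f ≡ ∑ xs g
∑-cong-All [] [] _ = refl
∑-cong-All (x ∷ xs) (px ∷ pxs) f≗g = cong₂ _+_ (f≗g x px) (∑-cong-All xs pxs f≗g)

∑-zero : (xs : List A) → ∑ xs (λ _ → 0) ≡ 0
∑-zero [] = refl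
∑-zero (x ∷ xs) = ∑-zero xs

∑-++ : (xs ys : List A) (f : A → ℕ) → ∑ (xs ++ ys) f ≡ ∑ xs f + ∑ ys f
∑-++ xs ys f = trans (cong sum (map-++ f xs ys)) (sum-++ (map f xs) (map f ys))

∑-+ : (xs : List A) (f g : A → ℕ) → ∑ xs (λ x → f x + g x) ≡ ∑ xs f + ∑ xs g
∑-+ [] f g = refl
∑-+ (x ∷ xs) f g = trans (cong (f x + g x +_) (∑-+ xs f g)) (interchange (f x) (g x) (∑ xs f) (∑ xs g))

∑-*ˡ : (xs : List A) (c : ℕ) (f : A → ℕ) → ∑ xs (λ x → c * f x) ≡ c * ∑ xs f
∑-*ˡ [] c f = sym (*-zeroʳ c)
∑-*ˡ (x ∷ xs) c f = trans (cong (c * f x +_) (∑-*ˡ xs c f)) (sym (*-distribˡ-+ c (f x) _))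

∑-*ʳ : (xs : List A) (c : ℕ) (f : A → ℕ) → ∑ xs (λ x → f x * c) ≡ ∑ xs f * c
∑-*ʳ [] c f = refl
∑-*ʳ (x ∷ xs) c f = trans (cong (f x * c +_) (∑-*ʳ xs c f)) (sym (*-distribʳ-+ c (f x) _))

∑-comm : (xs : List A) (ys : List B) (f : A → B → ℕ) →
  ∑ xs (λ a → ∑ ys (f a)) ≡ ∑ ys (λ b → ∑ xs (λ a → f a b))
∑-comm [] ys f = sym (∑-zero ys)
∑-comm (x ∷ xs) ys f = trans (cong (∑ ys (f x) +_) (∑-comm xs ys f)) (sym (∑-+ ys (f x) _))

∑-map : (r : B → A) (xs : List B) (f : A → ℕ) → ∑ (map r xs) f ≡ ∑ xs (f ∘ r)
∑-map r [] f = refl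
∑-map r (x ∷ xs) f = cong (f (r x) +_) (∑-map r xs f)

∑-concatMap : (g : B → List A) (xs : List B) (f : A → ℕ) →
  ∑ (concatMap g xs) f ≡ ∑ xs (λ b → ∑ (g b) f)
∑-concatMap g [] f = refl
∑-concatMap g (x ∷ xs) f = trans (∑-++ (g x) (concatMap g xs) f) (cong (∑ (g x) f +_) (∑-concatMap g xs f))

∑-filterᵇ : (S : A → Bool) (xs : List A) (g : A → ℕ) → ∑ xs (λ a → 𝟙 (S a) * g a) ≡ ∑ (filterᵇ S xs) g
∑-filterᵇ S [] g = refl
∑-filterᵇ S (x ∷ xs) g with S x
... | true = cong₂ _+_ (+-identityʳ (g x)) (∑-filterᵇ S xs g)
... | false = ∑-filterᵇ S xs g

length-filter≡∑ : {P : A → Set} (P? : Decidable P) (xs : List A) → length (filter P? xs) ≡ ∑ xs (𝟙 ∘ does ∘ P?)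
length-filter≡∑ P? [] = refl
length-filter≡∑ P? (x ∷ xs) with does (P? x)
... | true = cong suc (length-filter≡∑ P? xs)
... | false = length-filter≡∑ P? xs

All-upTo : ∀ n → All (_< n) (upTo n)
All-upTo n = applyUpTo⁺₁ (λ i → i) n (λ i<n → i<n)

∑-upTo-suc : ∀ n g → ∑ (upTo (suc n)) g ≡ ∑ (upTo n) g + g n
∑-upTo-suc n g = begin
  ∑ (upTo (suc n)) g        ≡⟨ cong (λ l → ∑ l g) (sym (upTo-∷ʳ n)) ⟩
  ∑ (upTo n ++ n ∷ []) g    ≡⟨ ∑-++ (upTo n) (n ∷ []) g ⟩
  ∑ (upTo n) g + (g n + 0)  ≡⟨ cong (∑ (upTo n) g +_) (+-identityʳ (g n)) ⟩
  ∑ (upTo n) g + g n        ∎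
  where open ≡-Reasoning

∑-upTo-suc′ : ∀ n g → ∑ (upTo (suc n)) g ≡ g 0 + ∑ (upTo n) (g ∘ suc)
∑-upTo-suc′ n g = cong (g 0 +_) (trans (cong (λ l → ∑ l g) (sym (map-upTo suc n))) (∑-map suc (upTo n) g))

∑-upTo-const : ∀ n c → ∑ (upTo n) (λ _ → c) ≡ n * c
∑-upTo-const zero c = refl
∑-upTo-const (suc n) c = trans (∑-upTo-suc n (λ _ → c)) (trans (cong (_+ c) (∑-upTo-const n c)) (+-comm (n * c) c))

words : ℕ → List ℕ → List Word
words zero L = [] ∷ []
words (suc n) L = concatMap (λ a → map (a ∷_) (words n L)) L

allWords≡words : ∀ n k → allWords n k ≡ words n (upTo k)
allWords≡words zero k = refl
allWords≡words (suc n) k rewrite allWords≡words n k = refl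

∑-words-suc : ∀ n L φ → ∑ (words (suc n) L) φ ≡ ∑ L (λ a → ∑ (words n L) (λ w → φ (a ∷ w)))
∑-words-suc n L φ = trans (∑-concatMap (λ a → map (a ∷_) (words n L)) L φ)
  (∑-cong L (λ a → ∑-map (a ∷_) (words n L) φ))

∑-words-cong : ∀ {P : ℕ → Set} n L {φ ψ : Word → ℕ} → All P L → (∀ w → All P w → φ w ≡ ψ w) →
  ∑ (words n L) φ ≡ ∑ (words n L) ψ
∑-words-cong zero L _ φ≗ψ = cong (_+ 0) (φ≗ψ [] [])
∑-words-cong (suc n) L {φ} {ψ} PL φ≗ψ = begin
  ∑ (words (suc n) L) φ                          ≡⟨ ∑-words-suc n L φ ⟩
  ∑ L (λ a → ∑ (words n L) (λ w → φ (a ∷ w)))    ≡⟨ ∑-cong-All L PL (λ a Pa →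
                                                      ∑-words-cong n L PL (λ w Pw → φ≗ψ (a ∷ w) (Pa ∷ Pw))) ⟩
  ∑ L (λ a → ∑ (words n L) (λ w → ψ (a ∷ w)))    ≡⟨ ∑-words-suc n L ψ ⟨
  ∑ (words (suc n) L) ψ                          ∎
  where open ≡-Reasoning

∑-words-all : ∀ n L S φ → ∑ (words n L) (λ w → 𝟙 (all S w) * φ w) ≡ ∑ (words n (filterᵇ S L)) φ
∑-words-all zero L S φ = cong (_+ 0) (+-identityʳ (φ []))
∑-words-all (suc n) L S φ = begin
  ∑ (words (suc n) L) (λ w → 𝟙 (all S w) * φ w)
    ≡⟨ ∑-words-suc n L _ ⟩
  ∑ L (λ a → ∑ (words n L) (λ w → 𝟙 (S a ∧ all S w) * φ (a ∷ w)))
    ≡⟨ ∑-cong L (λ a → ∑-cong (words n L) (λ w →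
         trans (cong (_* φ (a ∷ w)) (𝟙-∧ (S a) (all S w))) (*-assoc (𝟙 (S a)) _ _))) ⟩
  ∑ L (λ a → ∑ (words n L) (λ w → 𝟙 (S a) * (𝟙 (all S w) * φ (a ∷ w))))
    ≡⟨ ∑-cong L (λ a → ∑-*ˡ (words n L) (𝟙 (S a)) _) ⟩
  ∑ L (λ a → 𝟙 (S a) * ∑ (words n L) (λ w → 𝟙 (all S w) * φ (a ∷ w)))
    ≡⟨ ∑-cong L (λ a → cong (𝟙 (S a) *_) (∑-words-all n L S (λ w → φ (a ∷ w)))) ⟩
  ∑ L (λ a → 𝟙 (S a) * ∑ (words n (filterᵇ S L)) (λ w → φ (a ∷ w)))
    ≡⟨ ∑-filterᵇ S L _ ⟩
  ∑ (filterᵇ S L) (λ a → ∑ (words n (filterᵇ S L)) (λ w → φ (a ∷ w)))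
    ≡⟨ ∑-words-suc n (filterᵇ S L) φ ⟨
  ∑ (words (suc n) (filterᵇ S L)) φ
    ∎
  where open ≡-Reasoning

∑-words-map : ∀ n r L φ → ∑ (words n (map r L)) φ ≡ ∑ (words n L) (φ ∘ map r)
∑-words-map zero r L φ = refl
∑-words-map (suc n) r L φ = begin
  ∑ (words (suc n) (map r L)) φ                                   ≡⟨ ∑-words-suc n (map r L) φ ⟩
  ∑ (map r L) (λ a → ∑ (words n (map r L)) (λ w → φ (a ∷ w)))     ≡⟨ ∑-map r L _ ⟩
  ∑ L (λ b → ∑ (words n (map r L)) (λ w → φ (r b ∷ w)))           ≡⟨ ∑-cong L (λ b → ∑-words-map n r L (λ w → φ (r b ∷ w))) ⟩
  ∑ L (λ b → ∑ (words n L) (λ w → φ (r b ∷ map r w)))             ≡⟨ ∑-words-suc n L _ ⟨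
  ∑ (words (suc n) L) (φ ∘ map r)                                 ∎
  where open ≡-Reasoning

∑-words-first-occurrence : ∀ n k (φ : Word → ℕ) →
  ∑ (words n (upTo (suc k))) φ ≡ ∑ (words n (upTo k)) φ
    + ∑ (upTo n) (λ q → ∑ (words q (upTo k)) (λ α → ∑ (words (n ∸ suc q) (upTo (suc k))) (λ β → φ (α ++ k ∷ β))))
∑-words-first-occurrence zero k φ = sym (+-identityʳ _)
∑-words-first-occurrence (suc n) k φ = begin
  ∑ (words (suc n) U′) φ
    ≡⟨ ∑-words-suc n U′ φ ⟩
  ∑ U′ (λ a → ∑ (words n U′) (λ w → φ (a ∷ w)))
    ≡⟨ ∑-upTo-suc k _ ⟩
  ∑ U (λ a → ∑ (words n U′) (λ w → φ (a ∷ w))) + ∑ (words n U′) (λ w → φ (k ∷ w))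
    ≡⟨ cong₂ _+_ (∑-cong U (λ a → ∑-words-first-occurrence n k (λ w → φ (a ∷ w)))) (sym (+-identityʳ _)) ⟩
  ∑ U (λ a → ∑ (words n U) (λ w → φ (a ∷ w)) + ∑ (upTo n) (later a)) + split 0
    ≡⟨ cong (_+ split 0) (trans (∑-+ U _ _) (cong₂ _+_ (sym (∑-words-suc n U φ)) later-splits)) ⟩
  ∑ (words (suc n) U) φ + ∑ (upTo n) (split ∘ suc) + split 0
    ≡⟨ trans (+-assoc (∑ (words (suc n) U) φ) _ _) (cong (∑ (words (suc n) U) φ +_) (+-comm _ (split 0))) ⟩
  ∑ (words (suc n) U) φ + (split 0 + ∑ (upTo n) (split ∘ suc))
    ≡⟨ cong (∑ (words (suc n) U) φ +_) (∑-upTo-suc′ n split) ⟨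
  ∑ (words (suc n) U) φ + ∑ (upTo (suc n)) split
    ∎
  where
  open ≡-Reasoning
  U = upTo k
  U′ = upTo (suc k)
  later : ℕ → ℕ → ℕ
  later a q = ∑ (words q U) (λ α → ∑ (words (n ∸ suc q) U′) (λ β → φ (a ∷ α ++ k ∷ β)))
  split : ℕ → ℕ
  split q = ∑ (words q U) (λ α → ∑ (words (suc n ∸ suc q) U′) (λ β → φ (α ++ k ∷ β)))
  later-splits : ∑ U (λ a → ∑ (upTo n) (later a)) ≡ ∑ (upTo n) (split ∘ suc)
  later-splits = trans (∑-comm U (upTo n) later) (∑-cong (upTo n) (λ q → sym (∑-words-suc q U _)))

∑-words-by-maximum : ∀ n k (φ : Word → ℕ) → ∑ (words (suc n) (upTo k)) φ ≡
  ∑ (upTo (suc n)) (λ q → ∑ (upTo k) (λ m →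
    ∑ (words q (upTo m)) (λ α → ∑ (words (suc n ∸ suc q) (upTo (suc m))) (λ β → φ (α ++ m ∷ β)))))
∑-words-by-maximum n zero φ = sym (∑-zero (upTo (suc n)))
∑-words-by-maximum n (suc k) φ = begin
  ∑ (words (suc n) (upTo (suc k))) φ
    ≡⟨ ∑-words-first-occurrence (suc n) k φ ⟩
  ∑ (words (suc n) (upTo k)) φ + ∑ (upTo (suc n)) (λ q → split q k)
    ≡⟨ cong (_+ ∑ (upTo (suc n)) (λ q → split q k)) (∑-words-by-maximum n k φ) ⟩
  ∑ (upTo (suc n)) (λ q → ∑ (upTo k) (split q)) + ∑ (upTo (suc n)) (λ q → split q k)
    ≡⟨ ∑-+ (upTo (suc n)) (λ q → ∑ (upTo k) (split q)) (λ q → split q k) ⟨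
  ∑ (upTo (suc n)) (λ q → ∑ (upTo k) (split q) + split q k)
    ≡⟨ ∑-cong (upTo (suc n)) (λ q → sym (∑-upTo-suc k (split q))) ⟩
  ∑ (upTo (suc n)) (λ q → ∑ (upTo (suc k)) (split q))
    ∎
  where
  open ≡-Reasoning
  split : ℕ → ℕ → ℕ
  split q m = ∑ (words q (upTo m)) (λ α → ∑ (words (suc n ∸ suc q) (upTo (suc m))) (λ β → φ (α ++ m ∷ β)))

∑-words-not-below : ∀ j m (Ψ : Word → ℕ) →
  ∑ (words j (upTo (suc m))) (λ β → 𝟙 (not (anyBelow m β)) * Ψ β) ≡ Ψ (replicate j m)
∑-words-not-below zero m Ψ = trans (+-identityʳ _) (+-identityʳ _)
∑-words-not-below (suc j) m Ψ = begin
  ∑ (words (suc j) U′) (λ β → 𝟙 (not (anyBelow m β)) * Ψ β)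
    ≡⟨ ∑-words-suc j U′ _ ⟩
  ∑ U′ (λ a → ∑ (words j U′) (λ β → 𝟙 (not ((a <ᵇ m) ∨ anyBelow m β)) * Ψ (a ∷ β)))
    ≡⟨ ∑-upTo-suc m _ ⟩
  ∑ (upTo m) (λ a → ∑ (words j U′) (λ β → 𝟙 (not ((a <ᵇ m) ∨ anyBelow m β)) * Ψ (a ∷ β)))
    + ∑ (words j U′) (λ β → 𝟙 (not ((m <ᵇ m) ∨ anyBelow m β)) * Ψ (m ∷ β))
    ≡⟨ cong₂ _+_ (trans (∑-cong-All (upTo m) (All-upTo m) (λ a a<m →
                   trans (∑-cong (words j U′) (starts-below a<m)) (∑-zero (words j U′)))) (∑-zero (upTo m)))
                 (cong (λ b → ∑ (words j U′) (λ β → 𝟙 (not (b ∨ anyBelow m β)) * Ψ (m ∷ β))) (≥⇒≮ᵇ {m} ≤-refl)) ⟩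
  ∑ (words j U′) (λ β → 𝟙 (not (anyBelow m β)) * Ψ (m ∷ β))
    ≡⟨ ∑-words-not-below j m (Ψ ∘ (m ∷_)) ⟩
  Ψ (m ∷ replicate j m)
    ∎
  where
  open ≡-Reasoning
  U′ = upTo (suc m)
  starts-below : ∀ {a} → a < m → ∀ β → 𝟙 (not ((a <ᵇ m) ∨ anyBelow m β)) * Ψ (a ∷ β) ≡ 0
  starts-below a<m β rewrite <ᵇ-complete a<m = refl

not-anyBelow⇒replicate : ∀ {m} β → All (_< suc m) β → anyBelow m β ≡ false → β ≡ replicate (length β) m
not-anyBelow⇒replicate [] [] _ = refl
not-anyBelow⇒replicate {m} (y ∷ β) (y<1+m ∷ β<1+m) h with ∨-false⁻ {y <ᵇ m} h
... | y≮m , β-not-below with m≤n⇒m<n∨m≡n (≤-pred y<1+m)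
... | inj₁ y<m with () ← trans (sym (<ᵇ-complete y<m)) y≮m
... | inj₂ refl = cong (y ∷_) (not-anyBelow⇒replicate β β<1+m β-not-below)

-- Forbidden letters and relabelling by rank

maxW-≥ : ∀ σ → All (_≤ maxW σ) σ
maxW-≥ [] = []
maxW-≥ (x ∷ σ) = m≤m⊔n x (maxW σ) ∷ All.map (λ y≤ → ≤-trans y≤ (m≤n⊔m x (maxW σ))) (maxW-≥ σ)

maxW-< : ∀ {K} x σ → All (_< K) (x ∷ σ) → maxW (x ∷ σ) < K
maxW-< x [] (x<K ∷ []) = subst (_< _) (sym (⊔-identityʳ x)) x<K
maxW-< x (y ∷ σ) (x<K ∷ σ<K) = ⊔-lub x<K (maxW-< y σ σ<K)

∑-upTo-support : ∀ {M K} g → M ≤ K → (∀ v → M ≤ v → g v ≡ 0) → ∑ (upTo K) g ≡ ∑ (upTo M) g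
∑-upTo-support {M} {K} g M≤K g≡0 = trans (cong (λ t → ∑ (upTo t) g) (sym (m∸n+n≡m M≤K))) (extend (K ∸ M))
  where
  extend : ∀ d → ∑ (upTo (d + M)) g ≡ ∑ (upTo M) g
  extend zero = refl
  extend (suc d) = trans (∑-upTo-suc (d + M) g)
    (trans (cong₂ _+_ (extend d) (g≡0 (d + M) (m≤n+m M d))) (+-identityʳ _))

forb≡∑forbids : ∀ σ K → isBad σ ≡ false → All (_< K) σ → forb σ ≡ ∑ (upTo K) (𝟙 ∘ forbids σ)
forb≡∑forbids [] K _ _ = sym (∑-zero (upTo K))
forb≡∑forbids σ@(x ∷ σ′) K σ-good σ<K = begin
  forb σ
    ≡⟨ length-filter≡∑ (λ v → bad? (σ ++ M ∷ v ∷ [])) (upTo M) ⟩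
  ∑ (upTo M) (λ v → 𝟙 (does (bad? (σ ++ M ∷ v ∷ []))))
    ≡⟨ ∑-cong (upTo M) (λ v → cong 𝟙 (trans (does-bad? (σ ++ M ∷ v ∷ [])) (isBad-++-Mv M v σ σ<M))) ⟩
  ∑ (upTo M) (λ v → 𝟙 (isBad σ ∨ forbids σ v))
    ≡⟨ ∑-cong (upTo M) (λ v → cong (λ b → 𝟙 (b ∨ forbids σ v)) σ-good) ⟩
  ∑ (upTo M) (𝟙 ∘ forbids σ)
    ≡⟨ ∑-upTo-support (𝟙 ∘ forbids σ) (maxW-< x σ′ σ<K) zero-from-M ⟨
  ∑ (upTo K) (𝟙 ∘ forbids σ)
    ∎
  where
  open ≡-Reasoning
  M = suc (maxW σ)
  σ<M : All (_< M) σ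
  σ<M = All.map s≤s (maxW-≥ σ)
  zero-from-M : ∀ v → M ≤ v → 𝟙 (forbids σ v) ≡ 0
  zero-from-M v M≤v with forbids σ v in e
  ... | true = ⊥-elim (<⇒≱ (forbids⇒< σ v σ<M e) M≤v)
  ... | false = refl

rank : (ℕ → Bool) → ℕ → ℕ
rank S v = ∑ (upTo v) (𝟙 ∘ S)

rank-suc : ∀ S v → rank S (suc v) ≡ rank S v + 𝟙 (S v)
rank-suc S v = ∑-upTo-suc v (𝟙 ∘ S)

rank-mono-≤ : ∀ S {v w} → v ≤ w → rank S v ≤ rank S w
rank-mono-≤ S {v} {w} v≤w = subst (λ t → rank S v ≤ rank S t) (m∸n+n≡m v≤w) (grow (w ∸ v))
  where
  grow : ∀ d → rank S v ≤ rank S (d + v)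
  grow zero = ≤-refl
  grow (suc d) = ≤-trans (grow d) (subst (rank S (d + v) ≤_) (sym (rank-suc S (d + v))) (m≤m+n _ _))

rank-< : ∀ S {v w} → S v ≡ true → v < w → rank S v < rank S w
rank-< S {v} {w} Sv v<w = begin-strict
  rank S v             <⟨ m<m+n (rank S v) (s≤s z≤n) ⟩
  rank S v + 1         ≡⟨ cong (λ b → rank S v + 𝟙 b) Sv ⟨
  rank S v + 𝟙 (S v)   ≡⟨ rank-suc S v ⟨
  rank S (suc v)       ≤⟨ rank-mono-≤ S v<w ⟩
  rank S w             ∎
  where open ≤-Reasoning

rank-filterᵇ-upTo : ∀ S m → map (rank S) (filterᵇ S (upTo m)) ≡ upTo (rank S m)
rank-filterᵇ-upTo S zero = refl
rank-filterᵇ-upTo S (suc m) = begin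
  map (rank S) (filterᵇ S (upTo (suc m)))
    ≡⟨ cong (map (rank S) ∘ filterᵇ S) (sym (upTo-∷ʳ m)) ⟩
  map (rank S) (filterᵇ S (upTo m ++ m ∷ []))
    ≡⟨ cong (map (rank S)) (filter-++ (T? ∘ S) (upTo m) (m ∷ [])) ⟩
  map (rank S) (filterᵇ S (upTo m) ++ filterᵇ S (m ∷ []))
    ≡⟨ map-++ (rank S) (filterᵇ S (upTo m)) _ ⟩
  map (rank S) (filterᵇ S (upTo m)) ++ map (rank S) (filterᵇ S (m ∷ []))
    ≡⟨ cong (_++ map (rank S) (filterᵇ S (m ∷ []))) (rank-filterᵇ-upTo S m) ⟩
  upTo (rank S m) ++ map (rank S) (filterᵇ S (m ∷ []))
    ≡⟨ last-step ⟩
  upTo (rank S (suc m))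
    ∎
  where
  open ≡-Reasoning
  last-step : upTo (rank S m) ++ map (rank S) (filterᵇ S (m ∷ [])) ≡ upTo (rank S (suc m))
  last-step rewrite rank-suc S m with S m
  ... | true = trans (upTo-∷ʳ (rank S m)) (cong upTo (+-comm 1 (rank S m)))
  ... | false = trans (++-identityʳ (upTo (rank S m))) (cong upTo (sym (+-identityʳ (rank S m))))

All-filterᵇ-upTo : ∀ S m → All (λ y → S y ≡ true × y < m) (filterᵇ S (upTo m))
All-filterᵇ-upTo S m = All.zip (All.map (Equivalence.to T-≡) (all-filter (T? ∘ S) (upTo m)) , filter⁺ (T? ∘ S) (All-upTo m))

rank-not : ∀ b m → rank (not ∘ b) m + ∑ (upTo m) (𝟙 ∘ b) ≡ m
rank-not b m = begin
  rank (not ∘ b) m + ∑ (upTo m) (𝟙 ∘ b)     ≡⟨ ∑-+ (upTo m) (𝟙 ∘ not ∘ b) (𝟙 ∘ b) ⟨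
  ∑ (upTo m) (λ v → 𝟙 (not (b v)) + 𝟙 (b v)) ≡⟨ ∑-cong (upTo m) (λ v → complement (b v)) ⟩
  ∑ (upTo m) (λ _ → 1)                       ≡⟨ ∑-upTo-const m 1 ⟩
  m * 1                                      ≡⟨ *-identityʳ m ⟩
  m                                          ∎
  where
  open ≡-Reasoning
  complement : ∀ c → 𝟙 (not c) + 𝟙 c ≡ 1
  complement true = refl
  complement false = refl

module OrderEmbedding {P : ℕ → Set} (g : ℕ → ℕ) (g-< : ∀ {x y} → P x → P y → x < y → g x < g y) where

  ≡ᵇ-map : ∀ {x y} → P x → P y → (g x ≡ᵇ g y) ≡ (x ≡ᵇ y)
  ≡ᵇ-map {x} {y} px py with <-cmp x y
  ... | tri< x<y _ _ = trans (<⇒≢ᵇ (g-< px py x<y)) (sym (<⇒≢ᵇ x<y))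
  ... | tri≈ _ refl _ = trans (≡ᵇ-refl (g x)) (sym (≡ᵇ-refl x))
  ... | tri> _ _ y<x = trans (>⇒≢ᵇ (g-< py px y<x)) (sym (>⇒≢ᵇ y<x))

  <ᵇ-map : ∀ {x y} → P x → P y → (g x <ᵇ g y) ≡ (x <ᵇ y)
  <ᵇ-map {x} {y} px py with <-cmp x y
  ... | tri< x<y _ _ = trans (<ᵇ-complete (g-< px py x<y)) (sym (<ᵇ-complete x<y))
  ... | tri≈ _ refl _ = trans (≥⇒≮ᵇ {g x} ≤-refl) (sym (≥⇒≮ᵇ {x} ≤-refl))
  ... | tri> _ _ y<x = trans (≥⇒≮ᵇ (<⇒≤ (g-< py px y<x))) (sym (≥⇒≮ᵇ (<⇒≤ y<x)))

  occurs-map : ∀ {x} σ → P x → All P σ → occurs (g x) (map g σ) ≡ occurs x σ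
  occurs-map [] px [] = refl
  occurs-map (y ∷ σ) px (py ∷ pσ) = cong₂ _∨_ (≡ᵇ-map px py) (occurs-map σ px pσ)

  anyBelow-map : ∀ {x} σ → P x → All P σ → anyBelow (g x) (map g σ) ≡ anyBelow x σ
  anyBelow-map [] px [] = refl
  anyBelow-map (y ∷ σ) px (py ∷ pσ) = cong₂ _∨_ (<ᵇ-map py px) (anyBelow-map σ px pσ)

  head010-map : ∀ {x} σ → P x → All P σ → head010 (g x) (map g σ) ≡ head010 x σ
  head010-map [] px [] = refl
  head010-map (y ∷ σ) px (py ∷ pσ) =
    cong₂ _∨_ (cong₂ _∧_ (<ᵇ-map px py) (occurs-map σ px pσ)) (head010-map σ px pσ)

  head110-map : ∀ {x} σ → P x → All P σ → head110 (g x) (map g σ) ≡ head110 x σ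
  head110-map [] px [] = refl
  head110-map (y ∷ σ) px (py ∷ pσ) =
    cong₂ _∨_ (cong₂ _∧_ (≡ᵇ-map px py) (anyBelow-map σ px pσ)) (head110-map σ px pσ)

  isBad-map : ∀ σ → All P σ → isBad (map g σ) ≡ isBad σ
  isBad-map [] [] = refl
  isBad-map (x ∷ σ) (px ∷ pσ) =
    cong₂ _∨_ (cong₂ _∨_ (head010-map σ px pσ) (head110-map σ px pσ)) (isBad-map σ pσ)

  forbids-map : ∀ {v} σ → P v → All P σ → forbids (map g σ) (g v) ≡ forbids σ v
  forbids-map [] pv [] = refl
  forbids-map (x ∷ σ) pv (px ∷ pσ) = cong₂ _∨_ (≡ᵇ-map pv px)
    (cong₂ _∨_ (cong₂ _∧_ (<ᵇ-map pv px) (occurs-map σ px pσ)) (forbids-map σ pv pσ))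

good : Word → ℕ
good ω = 𝟙 (not (isBad ω))

goodWithForb : ℕ → Word → ℕ
goodWithForb f ω = good ω * 𝟙 (forb ω ≡ᵇ f)

jj≡∑ : ∀ n k f → jj n k f ≡ ∑ (words n (upTo k)) (goodWithForb f)
jj≡∑ n k f = begin
  jj n k f
    ≡⟨ length-filter≡∑ (λ ω → avoids? ω ×-dec (forb ω ≟ f)) (allWords n k) ⟩
  ∑ (allWords n k) (λ ω → 𝟙 (not (does (bad? ω)) ∧ (forb ω ≡ᵇ f)))
    ≡⟨ cong (λ l → ∑ l (λ ω → 𝟙 (not (does (bad? ω)) ∧ (forb ω ≡ᵇ f)))) (allWords≡words n k) ⟩
  ∑ (words n (upTo k)) (λ ω → 𝟙 (not (does (bad? ω)) ∧ (forb ω ≡ᵇ f)))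
    ≡⟨ ∑-cong (words n (upTo k)) (λ ω → trans (cong (λ b → 𝟙 (not b ∧ (forb ω ≡ᵇ f))) (does-bad? ω))
                                                (𝟙-∧ (not (isBad ω)) (forb ω ≡ᵇ f))) ⟩
  ∑ (words n (upTo k)) (goodWithForb f)
    ∎
  where open ≡-Reasoning

kk≡∑ : ∀ n k → kk n k ≡ ∑ (words n (upTo k)) good
kk≡∑ n k = trans (length-filter≡∑ avoids? (allWords n k))
  (trans (cong (λ l → ∑ l (λ ω → 𝟙 (not (does (bad? ω))))) (allWords≡words n k))
         (∑-cong (words n (upTo k)) (λ ω → cong (𝟙 ∘ not) (does-bad? ω))))

-- Once the largest letter m has occurred twice, every letter v ≤ m is forbidden.
forb-max-twice : ∀ m α τ → All (_≤ m) (α ++ m ∷ τ) → isBad (α ++ m ∷ τ) ≡ false → occurs m τ ≡ true →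
  forb (α ++ m ∷ τ) ≡ suc m
forb-max-twice m α τ ω≤m ω-good m∈τ = begin
  forb ω                           ≡⟨ forb≡∑forbids ω (suc m) ω-good (All.map s≤s ω≤m) ⟩
  ∑ (upTo (suc m)) (𝟙 ∘ forbids ω) ≡⟨ ∑-cong-All (upTo (suc m)) (All-upTo (suc m)) (λ v v<1+m → cong 𝟙 (all-forbidden v v<1+m)) ⟩
  ∑ (upTo (suc m)) (λ _ → 1)       ≡⟨ ∑-upTo-const (suc m) 1 ⟩
  suc m * 1                        ≡⟨ *-identityʳ (suc m) ⟩
  suc m                            ∎
  where
  open ≡-Reasoning
  ω = α ++ m ∷ τ
  all-forbidden : ∀ v → v < suc m → forbids ω v ≡ true
  all-forbidden v v<1+m = forbids-++ʳ α (m ∷ τ) v (forbids-repeated m τ v (≤-pred v<1+m) m∈τ)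

goodWithForb-repeated-max : ∀ f m j α γ → All (_< m) α → All (_< m) γ →
  goodWithForb f ((α ++ m ∷ γ) ++ replicate (suc j) m) ≡ good (α ++ m ∷ γ) * 𝟙 (suc m ≡ᵇ f)
goodWithForb-repeated-max f m j α γ α<m γ<m = begin
  good ω * 𝟙 (forb ω ≡ᵇ f)  ≡⟨ cong (λ b → 𝟙 (not b) * 𝟙 (forb ω ≡ᵇ f)) (isBad-++-replicate m j (α ++ m ∷ γ) σ≤m) ⟩
  good (α ++ m ∷ γ) * 𝟙 (forb ω ≡ᵇ f)  ≡⟨ forb-when-good ⟩
  good (α ++ m ∷ γ) * 𝟙 (suc m ≡ᵇ f)  ∎
  where
  open ≡-Reasoning
  ω = (α ++ m ∷ γ) ++ replicate (suc j) m
  σ≤m : All (_≤ m) (α ++ m ∷ γ)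
  σ≤m = ++⁺ (All.map <⇒≤ α<m) (≤-refl ∷ All.map <⇒≤ γ<m)
  τ = γ ++ replicate (suc j) m
  ω≤m : All (_≤ m) (α ++ m ∷ τ)
  ω≤m = subst (All (_≤ m)) (++-assoc α (m ∷ γ) _) (++⁺ σ≤m (replicate-≤ (suc j)))
    where
    replicate-≤ : ∀ i → All (_≤ m) (replicate i m)
    replicate-≤ zero = []
    replicate-≤ (suc i) = ≤-refl ∷ replicate-≤ i
  ω-good : isBad (α ++ m ∷ γ) ≡ false → isBad (α ++ m ∷ τ) ≡ false
  ω-good σ-bad = trans (cong isBad (sym (++-assoc α (m ∷ γ) _))) (trans (isBad-++-replicate m j (α ++ m ∷ γ) σ≤m) σ-bad)
  m∈τ : occurs m τ ≡ true
  m∈τ = trans (occurs-++ m γ _) (∨-trueʳ (occurs m γ) (∨-trueˡ _ (≡ᵇ-refl m)))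
  forb-when-good : good (α ++ m ∷ γ) * 𝟙 (forb ω ≡ᵇ f) ≡ good (α ++ m ∷ γ) * 𝟙 (suc m ≡ᵇ f)
  forb-when-good with isBad (α ++ m ∷ γ) in σ-bad
  ... | true = refl
  ... | false = cong (λ t → 1 * 𝟙 (t ≡ᵇ f)) (trans (cong forb (++-assoc α (m ∷ γ) (replicate (suc j) m)))
                  (forb-max-twice m α τ ω≤m (ω-good σ-bad) m∈τ))

-- After a second m only m may follow, since m m y with y < m is a 110.
goodWithForb-second-max : ∀ f m α γ β′ → All (_< m) α → All (_< m) γ → All (_< suc m) β′ →
  goodWithForb f (α ++ m ∷ (γ ++ m ∷ β′)) ≡ 𝟙 (not (anyBelow m β′)) * (good (α ++ m ∷ γ) * 𝟙 (suc m ≡ᵇ f))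
goodWithForb-second-max f m α γ β′ α<m γ<m β′≤m with anyBelow m β′ in below
... | true = cong (λ b → 𝟙 (not b) * 𝟙 (forb (α ++ m ∷ (γ ++ m ∷ β′)) ≡ᵇ f))
               (isBad-++ʳ α (m ∷ (γ ++ m ∷ β′)) (∨-trueˡ _ (∨-trueʳ (head010 m (γ ++ m ∷ β′)) m-m-below)))
  where
  m-m-below : head110 m (γ ++ m ∷ β′) ≡ true
  m-m-below = subst (_≡ true) (sym (head110-++ m γ (m ∷ β′)))
    (∨-trueʳ (head110 m γ) (∨-trueʳ (occurs m γ ∧ anyBelow m (m ∷ β′)) (∨-trueˡ _ (∧-true⁺ (≡ᵇ-refl m) below))))
... | false = begin
  goodWithForb f (α ++ m ∷ (γ ++ m ∷ β′))
    ≡⟨ cong (λ β → goodWithForb f (α ++ m ∷ (γ ++ m ∷ β))) (not-anyBelow⇒replicate β′ β′≤m below) ⟩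
  goodWithForb f (α ++ m ∷ (γ ++ replicate (suc (length β′)) m))
    ≡⟨ cong (goodWithForb f) (++-assoc α (m ∷ γ) _) ⟨
  goodWithForb f ((α ++ m ∷ γ) ++ replicate (suc (length β′)) m)
    ≡⟨ goodWithForb-repeated-max f m (length β′) α γ α<m γ<m ⟩
  good (α ++ m ∷ γ) * 𝟙 (suc m ≡ᵇ f)
    ≡⟨ *-identityˡ _ ⟨
  1 * (good (α ++ m ∷ γ) * 𝟙 (suc m ≡ᵇ f))
    ∎
  where open ≡-Reasoning

≡ᵇ-suc-+ : ∀ i x f → (suc (i + x) ≡ᵇ f) ≡ (i <ᵇ f) ∧ (x ≡ᵇ f ∸ i ∸ 1)
≡ᵇ-suc-+ zero x zero = refl
≡ᵇ-suc-+ zero x (suc f) = refl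
≡ᵇ-suc-+ (suc i) x zero = refl
≡ᵇ-suc-+ (suc i) x (suc f) = ≡ᵇ-suc-+ i x f

anyForbidden≡not-all : ∀ α γ → anyForbidden α γ ≡ not (all (not ∘ forbids α) γ)
anyForbidden≡not-all α [] = refl
anyForbidden≡not-all α (y ∷ γ) rewrite anyForbidden≡not-all α γ with forbids α y
... | true = refl
... | false = refl

anyForbidden-allowed : ∀ {m} α γ → All (λ y → not (forbids α y) ≡ true × y < m) γ → anyForbidden α γ ≡ false
anyForbidden-allowed α [] [] = refl
anyForbidden-allowed α (y ∷ γ) ((_ , _) ∷ γ-allowed) with forbids α y
... | false = anyForbidden-allowed α γ γ-allowed

𝟙-∨ : ∀ a b → 𝟙 (a ∨ b) ≡ 𝟙 a + 𝟙 (not a) * 𝟙 b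
𝟙-∨ true b = refl
𝟙-∨ false b = sym (+-identityʳ (𝟙 b))

module Extensions (m : ℕ) (α : Word) (α<m : All (_< m) α) (α-good : isBad α ≡ false) where

  allowed : ℕ → Bool
  allowed = not ∘ forbids α

  Allowed : ℕ → Set
  Allowed y = allowed y ≡ true × y < m

  relabel : ℕ → ℕ
  relabel = rank allowed

  open OrderEmbedding {Allowed} relabel (λ px _ → rank-< allowed (proj₁ px))

  forb-α : forb α ≡ ∑ (upTo m) (𝟙 ∘ forbids α)
  forb-α = forb≡∑forbids α m α-good α<m

  relabel-m : relabel m ≡ m ∸ forb α
  relabel-m = sym (begin
    m ∸ forb α                                                   ≡⟨ cong (m ∸_) forb-α ⟩
    m ∸ ∑ (upTo m) (𝟙 ∘ forbids α)                               ≡⟨ cong (_∸ ∑ (upTo m) (𝟙 ∘ forbids α)) (rank-not (forbids α) m) ⟨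
    relabel m + ∑ (upTo m) (𝟙 ∘ forbids α) ∸ ∑ (upTo m) (𝟙 ∘ forbids α) ≡⟨ m+n∸n≡m (relabel m) (∑ (upTo m) (𝟙 ∘ forbids α)) ⟩
    relabel m                                                    ∎)
    where open ≡-Reasoning

  relabel-< : ∀ γ → All Allowed γ → All (_< relabel m) (map relabel γ)
  relabel-< γ γ-allowed = map⁺ (All.map (λ (a , y<m) → rank-< allowed a y<m) γ-allowed)

  forb-relabel : ∀ γ → All Allowed γ → isBad γ ≡ false →
    ∑ (upTo m) (λ v → 𝟙 (allowed v) * 𝟙 (forbids γ v)) ≡ forb (map relabel γ)
  forb-relabel γ γ-allowed γ-good = begin
    ∑ (upTo m) (λ v → 𝟙 (allowed v) * 𝟙 (forbids γ v))
      ≡⟨ ∑-filterᵇ allowed (upTo m) _ ⟩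
    ∑ (filterᵇ allowed (upTo m)) (𝟙 ∘ forbids γ)
      ≡⟨ ∑-cong-All (filterᵇ allowed (upTo m)) (All-filterᵇ-upTo allowed m)
           (λ v v-allowed → cong 𝟙 (sym (forbids-map γ v-allowed γ-allowed))) ⟩
    ∑ (filterᵇ allowed (upTo m)) (𝟙 ∘ forbids (map relabel γ) ∘ relabel)
      ≡⟨ ∑-map relabel (filterᵇ allowed (upTo m)) _ ⟨
    ∑ (map relabel (filterᵇ allowed (upTo m))) (𝟙 ∘ forbids (map relabel γ))
      ≡⟨ cong (λ l → ∑ l (𝟙 ∘ forbids (map relabel γ))) (rank-filterᵇ-upTo allowed m) ⟩
    ∑ (upTo (relabel m)) (𝟙 ∘ forbids (map relabel γ))
      ≡⟨ forb≡∑forbids (map relabel γ) (relabel m) (trans (isBad-map γ γ-allowed) γ-good) (relabel-< γ γ-allowed) ⟨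
    forb (map relabel γ)
      ∎
    where open ≡-Reasoning

  forb-extension : ∀ γ → All Allowed γ → isBad γ ≡ false →
    forb (α ++ m ∷ γ) ≡ suc (forb α + forb (map relabel γ))
  forb-extension γ γ-allowed γ-good = begin
    forb (α ++ m ∷ γ)
      ≡⟨ forb≡∑forbids (α ++ m ∷ γ) (suc m) ω-good ω<1+m ⟩
    ∑ (upTo (suc m)) (𝟙 ∘ forbids (α ++ m ∷ γ))
      ≡⟨ ∑-upTo-suc m _ ⟩
    ∑ (upTo m) (𝟙 ∘ forbids (α ++ m ∷ γ)) + 𝟙 (forbids (α ++ m ∷ γ) m)
      ≡⟨ cong₂ _+_ (∑-cong-All (upTo m) (All-upTo m) (λ v v<m →
           trans (cong 𝟙 (forbids-++-∷ m α γ v α<m γ<m no-forbidden v<m)) (𝟙-∨ (forbids α v) (forbids γ v))))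
         (cong 𝟙 (forbids-++-∷-self m α γ)) ⟩
    ∑ (upTo m) (λ v → 𝟙 (forbids α v) + 𝟙 (allowed v) * 𝟙 (forbids γ v)) + 1
      ≡⟨ cong (_+ 1) (∑-+ (upTo m) _ _) ⟩
    ∑ (upTo m) (𝟙 ∘ forbids α) + ∑ (upTo m) (λ v → 𝟙 (allowed v) * 𝟙 (forbids γ v)) + 1
      ≡⟨ cong₂ (λ s t → s + t + 1) (sym forb-α) (forb-relabel γ γ-allowed γ-good) ⟩
    forb α + forb (map relabel γ) + 1
      ≡⟨ +-comm _ 1 ⟩
    suc (forb α + forb (map relabel γ))
      ∎
    where
    open ≡-Reasoning
    γ<m : All (_< m) γ
    γ<m = All.map proj₂ γ-allowed
    no-forbidden : anyForbidden α γ ≡ false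
    no-forbidden = anyForbidden-allowed α γ γ-allowed
    ω-good : isBad (α ++ m ∷ γ) ≡ false
    ω-good = trans (isBad-++-∷ m α γ α<m γ<m) (cong₂ _∨_ α-good (cong₂ _∨_ γ-good no-forbidden))
    ω<1+m : All (_< suc m) (α ++ m ∷ γ)
    ω<1+m = ++⁺ (All.map m<n⇒m<1+n α<m) (n<1+n m ∷ All.map m<n⇒m<1+n γ<m)

  ∑-extensions : ∀ ℓ (ψ : ℕ → ℕ) →
    ∑ (words ℓ (upTo m)) (λ γ → good (α ++ m ∷ γ) * ψ (forb (α ++ m ∷ γ)))
      ≡ ∑ (words ℓ (upTo (m ∸ forb α))) (λ γ′ → good γ′ * ψ (suc (forb α + forb γ′)))
  ∑-extensions ℓ ψ = begin
    ∑ (words ℓ (upTo m)) (λ γ → good (α ++ m ∷ γ) * ψ (forb (α ++ m ∷ γ)))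
      ≡⟨ ∑-words-cong ℓ (upTo m) (All-upTo m) split-badness ⟩
    ∑ (words ℓ (upTo m)) (λ γ → 𝟙 (all allowed γ) * (good γ * ψ (forb (α ++ m ∷ γ))))
      ≡⟨ ∑-words-all ℓ (upTo m) allowed _ ⟩
    ∑ (words ℓ (filterᵇ allowed (upTo m))) (λ γ → good γ * ψ (forb (α ++ m ∷ γ)))
      ≡⟨ ∑-words-cong ℓ (filterᵇ allowed (upTo m)) (All-filterᵇ-upTo allowed m) relabel-summand ⟩
    ∑ (words ℓ (filterᵇ allowed (upTo m))) (Φ ∘ map relabel)
      ≡⟨ ∑-words-map ℓ relabel (filterᵇ allowed (upTo m)) Φ ⟨
    ∑ (words ℓ (map relabel (filterᵇ allowed (upTo m)))) Φ
      ≡⟨ cong (λ l → ∑ (words ℓ l) Φ) (trans (rank-filterᵇ-upTo allowed m) (cong upTo relabel-m)) ⟩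
    ∑ (words ℓ (upTo (m ∸ forb α))) Φ
      ∎
    where
    open ≡-Reasoning
    Φ : Word → ℕ
    Φ γ′ = good γ′ * ψ (suc (forb α + forb γ′))
    split-badness : ∀ γ → All (_< m) γ →
      good (α ++ m ∷ γ) * ψ (forb (α ++ m ∷ γ))
        ≡ 𝟙 (all allowed γ) * (good γ * ψ (forb (α ++ m ∷ γ)))
    split-badness γ γ<m rewrite isBad-++-∷ m α γ α<m γ<m | α-good | anyForbidden≡not-all α γ =
      distribute (isBad γ) (all allowed γ) (ψ (forb (α ++ m ∷ γ)))
      where
      distribute : ∀ a b x → 𝟙 (not (a ∨ not b)) * x ≡ 𝟙 b * (𝟙 (not a) * x)
      distribute true b x = sym (*-zeroʳ (𝟙 b))
      distribute false true x = cong (_+ 0) (sym (+-identityʳ x))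
      distribute false false x = refl
    relabel-summand : ∀ γ → All Allowed γ → good γ * ψ (forb (α ++ m ∷ γ)) ≡ Φ (map relabel γ)
    relabel-summand γ γ-allowed rewrite isBad-map γ γ-allowed with isBad γ in γ-bad
    ... | true = refl
    ... | false = cong (λ t → 1 * ψ t) (forb-extension γ γ-allowed γ-bad)

  ∑-extensions-without-m : ∀ j f →
    ∑ (words j (upTo m)) (goodWithForb f ∘ (λ γ → α ++ m ∷ γ))
      ≡ 𝟙 (forb α <ᵇ f) * jj j (m ∸ forb α) (f ∸ forb α ∸ 1)
  ∑-extensions-without-m j f = begin
    ∑ (words j (upTo m)) (λ γ → good (α ++ m ∷ γ) * 𝟙 (forb (α ++ m ∷ γ) ≡ᵇ f))
      ≡⟨ ∑-extensions j (λ x → 𝟙 (x ≡ᵇ f)) ⟩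
    ∑ (words j (upTo (m ∸ i))) (λ γ′ → good γ′ * 𝟙 (suc (i + forb γ′) ≡ᵇ f))
      ≡⟨ ∑-cong (words j (upTo (m ∸ i))) (λ γ′ → shift (good γ′) (forb γ′)) ⟩
    ∑ (words j (upTo (m ∸ i))) (λ γ′ → 𝟙 (i <ᵇ f) * goodWithForb (f ∸ i ∸ 1) γ′)
      ≡⟨ ∑-*ˡ (words j (upTo (m ∸ i))) (𝟙 (i <ᵇ f)) (goodWithForb (f ∸ i ∸ 1)) ⟩
    𝟙 (i <ᵇ f) * ∑ (words j (upTo (m ∸ i))) (goodWithForb (f ∸ i ∸ 1))
      ≡⟨ cong (𝟙 (i <ᵇ f) *_) (jj≡∑ j (m ∸ i) (f ∸ i ∸ 1)) ⟨
    𝟙 (i <ᵇ f) * jj j (m ∸ i) (f ∸ i ∸ 1)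
      ∎
    where
    open ≡-Reasoning
    i = forb α
    shift : ∀ g x → g * 𝟙 (suc (i + x) ≡ᵇ f) ≡ 𝟙 (i <ᵇ f) * (g * 𝟙 (x ≡ᵇ f ∸ i ∸ 1))
    shift g x rewrite ≡ᵇ-suc-+ i x f | 𝟙-∧ (i <ᵇ f) (x ≡ᵇ f ∸ i ∸ 1) = x*yz≡y*xz g (𝟙 (i <ᵇ f)) _

  ∑-extensions-with-m : ∀ ℓ j f →
    ∑ (words ℓ (upTo m)) (λ γ → ∑ (words j (upTo (suc m))) (λ β′ → goodWithForb f (α ++ m ∷ (γ ++ m ∷ β′))))
      ≡ 𝟙 (suc m ≡ᵇ f) * kk ℓ (m ∸ forb α)
  ∑-extensions-with-m ℓ j f = begin
    ∑ (words ℓ (upTo m)) (λ γ → ∑ (words j (upTo (suc m))) (λ β′ → goodWithForb f (α ++ m ∷ (γ ++ m ∷ β′))))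
      ≡⟨ ∑-words-cong ℓ (upTo m) (All-upTo m) (λ γ γ<m →
           trans (∑-words-cong j (upTo (suc m)) (All-upTo (suc m)) (λ β′ β′≤m →
                    goodWithForb-second-max f m α γ β′ α<m γ<m β′≤m))
                 (∑-words-not-below j m (λ _ → good (α ++ m ∷ γ) * 𝟙 (suc m ≡ᵇ f)))) ⟩
    ∑ (words ℓ (upTo m)) (λ γ → good (α ++ m ∷ γ) * 𝟙 (suc m ≡ᵇ f))
      ≡⟨ ∑-extensions ℓ (λ _ → 𝟙 (suc m ≡ᵇ f)) ⟩
    ∑ (words ℓ (upTo (m ∸ forb α))) (λ γ′ → good γ′ * 𝟙 (suc m ≡ᵇ f))
      ≡⟨ ∑-*ʳ (words ℓ (upTo (m ∸ forb α))) (𝟙 (suc m ≡ᵇ f)) good ⟩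
    ∑ (words ℓ (upTo (m ∸ forb α))) good * 𝟙 (suc m ≡ᵇ f)
      ≡⟨ cong (_* 𝟙 (suc m ≡ᵇ f)) (kk≡∑ ℓ (m ∸ forb α)) ⟨
    kk ℓ (m ∸ forb α) * 𝟙 (suc m ≡ᵇ f)
      ≡⟨ *-comm _ (𝟙 (suc m ≡ᵇ f)) ⟩
    𝟙 (suc m ≡ᵇ f) * kk ℓ (m ∸ forb α)
      ∎
    where open ≡-Reasoning

∑-𝟙-≡ᵇ : ∀ f x (G : ℕ → ℕ) → ∑ (upTo f) (λ i → 𝟙 (x ≡ᵇ i) * G i) ≡ 𝟙 (x <ᵇ f) * G x
∑-𝟙-≡ᵇ zero x G = refl
∑-𝟙-≡ᵇ (suc f) x G =
  trans (∑-upTo-suc f _) (trans (cong (_+ 𝟙 (x ≡ᵇ f) * G f) (∑-𝟙-≡ᵇ f x G)) (last-term (<-cmp x f)))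
  where
  last-term : Tri (x < f) (x ≡ f) (x > f) → 𝟙 (x <ᵇ f) * G x + 𝟙 (x ≡ᵇ f) * G f ≡ 𝟙 (x <ᵇ suc f) * G x
  last-term (tri< x<f _ _) rewrite <ᵇ-complete x<f | <⇒≢ᵇ x<f | <ᵇ-complete (m<n⇒m<1+n x<f) = +-identityʳ _
  last-term (tri≈ _ refl _) rewrite ≥⇒≮ᵇ {x} {x} ≤-refl | ≡ᵇ-refl x | <ᵇ-complete (n<1+n x) = refl
  last-term (tri> _ _ f<x) rewrite ≥⇒≮ᵇ (<⇒≤ f<x) | >⇒≢ᵇ f<x | ≥⇒≮ᵇ {x} {suc f} f<x = refl

δ≡𝟙 : ∀ f m → δ f (m + 1) ≡ 𝟙 (suc m ≡ᵇ f)
δ≡𝟙 f m with f ≟ m + 1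
... | yes f≡m+1 = cong 𝟙 (sym (≡ᵇ-complete (sym (trans f≡m+1 (+-comm m 1)))))
... | no f≢m+1 = cong 𝟙 (sym (¬-not λ e → f≢m+1 (trans (sym (≡ᵇ-sound e)) (+-comm 1 m))))

forb-≤ : ∀ m α → All (_< m) α → isBad α ≡ false → forb α ≤ m
forb-≤ m α α<m α-good = subst (_≤ m) (sym (forb≡∑forbids α m α-good α<m))
  (subst (∑ (upTo m) (𝟙 ∘ forbids α) ≤_) (rank-not (forbids α) m) (m≤n+m _ _))

-- The bracket of the recurrence: m is the largest letter, i = forb α, and j the length after m.
completions : ℕ → ℕ → ℕ → ℕ → ℕ
completions f m i j = jj j (m ∸ i) (f ∸ i ∸ 1) + δ f (m + 1) * ∑ (upTo j) (λ ℓ → kk ℓ (m ∸ i))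

∑-after-first-max : ∀ f m j α → All (_< m) α →
  ∑ (words j (upTo (suc m))) (λ β → goodWithForb f (α ++ m ∷ β)) ≡ ∑ (upTo f) (λ i → goodWithForb i α * completions f m i j)
∑-after-first-max f m j α α<m with isBad α in isBad-α
... | true = trans (∑-words-cong j (upTo (suc m)) (All-upTo (suc m)) (λ β _ →
                      cong (λ b → 𝟙 (not b) * 𝟙 (forb (α ++ m ∷ β) ≡ᵇ f)) (isBad-++ˡ α (m ∷ β) isBad-α)))
                   (trans (∑-zero (words j (upTo (suc m)))) (sym (∑-zero (upTo f))))
... | false = begin
  ∑ (words j U′) (λ β → goodWithForb f (α ++ m ∷ β))
    ≡⟨ ∑-words-first-occurrence j m _ ⟩
  ∑ (words j U) (λ γ → goodWithForb f (α ++ m ∷ γ))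
    + ∑ (upTo j) (λ ℓ → ∑ (words ℓ U) (λ γ → ∑ (words (j ∸ suc ℓ) U′) (λ β′ → goodWithForb f (α ++ m ∷ (γ ++ m ∷ β′)))))
    ≡⟨ cong₂ _+_ (∑-extensions-without-m j f) (∑-cong (upTo j) (λ ℓ → ∑-extensions-with-m ℓ (j ∸ suc ℓ) f)) ⟩
  𝟙 (i <ᵇ f) * jj′ + ∑ (upTo j) (λ ℓ → D * kk ℓ (m ∸ i))
    ≡⟨ cong (𝟙 (i <ᵇ f) * jj′ +_) (∑-*ˡ (upTo j) D _) ⟩
  𝟙 (i <ᵇ f) * jj′ + D * ∑kk
    ≡⟨ factor (i <ᵇ f) (suc m ≡ᵇ f) jj′ ∑kk i<f-if-m+1≡f ⟩
  𝟙 (i <ᵇ f) * (jj′ + D * ∑kk)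
    ≡⟨ cong (λ t → 𝟙 (i <ᵇ f) * (jj′ + t * ∑kk)) (δ≡𝟙 f m) ⟨
  𝟙 (i <ᵇ f) * completions f m i j
    ≡⟨ ∑-𝟙-≡ᵇ f i (λ i′ → completions f m i′ j) ⟨
  ∑ (upTo f) (λ i′ → 𝟙 (i ≡ᵇ i′) * completions f m i′ j)
    ≡⟨ ∑-cong (upTo f) (λ i′ → cong (_* completions f m i′ j) (sym (*-identityˡ (𝟙 (i ≡ᵇ i′))))) ⟩
  ∑ (upTo f) (λ i′ → 1 * 𝟙 (i ≡ᵇ i′) * completions f m i′ j)
    ∎
  where
  open ≡-Reasoning
  open Extensions m α α<m isBad-α
  U = upTo m
  U′ = upTo (suc m)
  i = forb α
  jj′ = jj j (m ∸ i) (f ∸ i ∸ 1)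
  ∑kk = ∑ (upTo j) (λ ℓ → kk ℓ (m ∸ i))
  D = 𝟙 (suc m ≡ᵇ f)
  i<f-if-m+1≡f : (suc m ≡ᵇ f) ≡ true → (i <ᵇ f) ≡ true
  i<f-if-m+1≡f e = subst (λ t → (i <ᵇ t) ≡ true) (≡ᵇ-sound {suc m} {f} e) (<ᵇ-complete (s≤s (forb-≤ m α α<m isBad-α)))
  factor : ∀ c d a b → (d ≡ true → c ≡ true) → 𝟙 c * a + 𝟙 d * b ≡ 𝟙 c * (a + 𝟙 d * b)
  factor true d a b _ = trans (cong (_+ 𝟙 d * b) (*-identityˡ a)) (sym (*-identityˡ _))
  factor false false a b _ = refl
  factor false true a b d⇒c with () ← d⇒c refl

∑-prefixes : ∀ q m f (C : ℕ → ℕ) →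
  ∑ (words q (upTo m)) (λ α → ∑ (upTo f) (λ i → goodWithForb i α * C i)) ≡ ∑ (upTo f) (λ i → jj q m i * C i)
∑-prefixes q m f C = begin
  ∑ (words q (upTo m)) (λ α → ∑ (upTo f) (λ i → goodWithForb i α * C i))
    ≡⟨ ∑-comm (words q (upTo m)) (upTo f) _ ⟩
  ∑ (upTo f) (λ i → ∑ (words q (upTo m)) (λ α → goodWithForb i α * C i))
    ≡⟨ ∑-cong (upTo f) (λ i → ∑-*ʳ (words q (upTo m)) (C i) (goodWithForb i)) ⟩
  ∑ (upTo f) (λ i → ∑ (words q (upTo m)) (goodWithForb i) * C i)
    ≡⟨ ∑-cong (upTo f) (λ i → cong (_* C i) (sym (jj≡∑ q m i))) ⟩
  ∑ (upTo f) (λ i → jj q m i * C i)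
    ∎
  where open ≡-Reasoning

lemma5 : (n k f : ℕ) → 1 ≤ n →
    jj n k f ≡
      Σ< n (λ q → let p = suc q in
        Σ< f (λ i →
          Σ< k (λ m →
            jj (p ∸ 1) m i *
              (jj (n ∸ p) (m ∸ i) (f ∸ i ∸ 1)
                + δ f (m + 1) * Σ< (n ∸ p) (λ ℓ → kk ℓ (m ∸ i))))))
lemma5 (suc n) k f _ = begin
  jj (suc n) k f
    ≡⟨ jj≡∑ (suc n) k f ⟩
  ∑ (words (suc n) (upTo k)) (goodWithForb f)
    ≡⟨ ∑-words-by-maximum n k (goodWithForb f) ⟩
  ∑ (upTo (suc n)) (λ q → ∑ (upTo k) (λ m → ∑ (words q (upTo m)) (λ α →
    ∑ (words (suc n ∸ suc q) (upTo (suc m))) (λ β → goodWithForb f (α ++ m ∷ β)))))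
    ≡⟨ ∑-cong (upTo (suc n)) (λ q → ∑-cong (upTo k) (λ m →
         trans (∑-words-cong q (upTo m) (All-upTo m) (λ α α<m → ∑-after-first-max f m (suc n ∸ suc q) α α<m))
               (∑-prefixes q m f (λ i → completions f m i (suc n ∸ suc q))))) ⟩
  ∑ (upTo (suc n)) (λ q → ∑ (upTo k) (λ m → ∑ (upTo f) (λ i → jj q m i * completions f m i (suc n ∸ suc q))))
    ≡⟨ ∑-cong (upTo (suc n)) (λ q → ∑-comm (upTo k) (upTo f) _) ⟩
  ∑ (upTo (suc n)) (λ q → ∑ (upTo f) (λ i → ∑ (upTo k) (λ m → jj q m i * completions f m i (suc n ∸ suc q))))
    ∎
  where open ≡-Reasoning
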